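{- Let $p$ be an odd prime, $k_1,k_2$ positive integers with $k_1+k_2$ odd, and $a_1,a_2$ integers coprime to $p$. Then $(\mathbb CL_{p^{k_1}}(a_1)\otimes\mathbb CL_{p^{k_2}}(a_2))^{\Gamma_0(p)}=0$.
   Context: $e(x)=e^{2\pi ix}$. For odd $n\ge1$ and $\gcd(b,n)=1$, $L_n(b)$ is the discriminant form $\mathbb Z/n\mathbb Z$ with $Q(\gamma)=b\gamma^2/n$, $B(x,y)=Q(x+y)-Q(x)-Q(y)$, and signature determined by $\sum_{\gamma}e(Q(\gamma))=\sqrt n\,e(\mathrm{sign}/8)$. $\mathbb CL_n(b)$ has basis $\mathbf e^\gamma$ and carries the Weil representation of $\mathrm{SL}_2(\mathbb Z)$: $\rho(T)\mathbf e^\gamma=e(Q(\gamma))\mathbf e^\gamma$, $\rho(S)\mathbf e^\gamma=\frac{e(-\mathrm{sign}/8)}{\sqrt n}\sum_\beta e(-B(\gamma,\beta))\mathbf e^\beta$, $T=\begin{psmallmatrix}1&1\\0&1\end{psmallmatrix}$, $S=\begin{psmallmatrix}0&-1\\1&0\end{psmallmatrix}$. The tensor product carries the tensor product representation and $V^\Gamma$ denotes the $\Gamma$-invariant vectors. -}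

module Defs where

open import Level using (Level; _⊔_) renaming (suc to lsuc)
open import Data.Nat as ℕ using (ℕ; zero; suc; _∸_)
open import Data.Fin using (Fin; toℕ)
open import Data.Integer as ℤ using (ℤ; +_; -[1+_])
open import Data.Integer.Divisibility using (_∣_)
open import Data.List using (List; []; _∷_)
open import Algebra.Bundles using (CommutativeRing)
open import Relation.Nullary using (¬_)

-- A field of characteristic 0 (stdlib has no Field bundle).
-- Inverse is a total function, specified only on nonzero elements.

ofℕ : ∀ {c ℓ} (R : CommutativeRing c ℓ) → ℕ → CommutativeRing.Carrier R
ofℕ R zero    = CommutativeRing.0# R
ofℕ R (suc n) = CommutativeRing._+_ R (CommutativeRing.1# R) (ofℕ R n)

record CharZeroField (c ℓ : Level) : Set (lsuc (c ⊔ ℓ)) where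
  field
    commRing : CommutativeRing c ℓ
  open CommutativeRing commRing public
  field
    _⁻¹      : Carrier → Carrier
    inverseʳ : ∀ x → ¬ (x ≈ 0#) → (x * (x ⁻¹)) ≈ 1#
    char0    : ∀ n → ¬ (ofℕ commRing (suc n) ≈ 0#)

module FieldOps {c ℓ : Level} (F : CharZeroField c ℓ) where
  open CharZeroField F

  pow : Carrier → ℕ → Carrier
  pow x zero    = 1#
  pow x (suc n) = x * pow x n

  IsPrimitiveRoot : Carrier → ℕ → Set ℓ
  IsPrimitiveRoot ζ N =
    (pow ζ N ≈ 1#) × (∀ d → 0 ℕ.< d → d ℕ.< N → ¬ (pow ζ d ≈ 1#))
    where open import Data.Product using (_×_)

  sumFin : ∀ {n} → (Fin n → Carrier) → Carrier
  sumFin {zero}  f = 0#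
  sumFin {suc n} f = f Fin.zero + sumFin (λ i → f (Fin.suc i))
    where import Data.Fin as Fin

record M2 : Set where
  constructor mat
  field
    a b c d : ℤ

_·M_ : M2 → M2 → M2
mat a b c d ·M mat a' b' c' d' =
  mat (a ℤ.* a' ℤ.+ b ℤ.* c') (a ℤ.* b' ℤ.+ b ℤ.* d')
      (c ℤ.* a' ℤ.+ d ℤ.* c') (c ℤ.* b' ℤ.+ d ℤ.* d')

I₂ : M2
I₂ = mat (+ 1) (+ 0) (+ 0) (+ 1)

data Gen : Set where
  genS genT : Gen

genMat : Gen → M2
genMat genS = mat (+ 0) (ℤ.- (+ 1)) (+ 1) (+ 0)
genMat genT = mat (+ 1) (+ 1) (+ 0) (+ 1)

-- S and T generate SL₂(ℤ) as a monoid (S⁴ = 1, T⁻¹ = STSTS³),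
-- so every element of SL₂(ℤ) is wordMat w for some word w.
wordMat : List Gen → M2
wordMat []      = I₂
wordMat (g ∷ w) = genMat g ·M wordMat w

InΓ₀ : ℕ → List Gen → Set
InΓ₀ p w = (+ p) ∣ M2.c (wordMat w)

-- The Weil representation on ℂL_{n₁}(a₁) ⊗ ℂL_{n₂}(a₂), with scalars in
-- a char-0 field F containing ζ = e(1/(n₁ n₂)) (a primitive n₁n₂-th root
-- of unity).  Vectors are coordinate functions γ = (γ₁,γ₂) ↦ v(γ₁,γ₂)
-- in the basis e^{γ₁} ⊗ e^{γ₂}.

module Weil {c ℓ : Level} (F : CharZeroField c ℓ) (ζ : CharZeroField.Carrier F)
            (n₁ n₂ : ℕ) (a₁ a₂ : ℤ) where
  open CharZeroField F
  open FieldOps F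

  N : ℕ
  N = n₁ ℕ.* n₂

  -- e(z / N) for an integer z  (ζ⁻¹ = ζ^(N-1) since ζ^N = 1)
  eN : ℤ → Carrier
  eN (+ m)      = pow ζ m
  eN -[1+ m ]   = pow (pow ζ (N ∸ 1)) (suc m)

  Z : ∀ {n} → Fin n → ℤ
  Z γ = + toℕ γ

  -- e(Q₁(γ)) = e(a₁γ²/n₁) = e(a₁γ² n₂ / N), similarly for Q₂
  eQ₁ : Fin n₁ → Carrier
  eQ₁ γ = eN (a₁ ℤ.* Z γ ℤ.* Z γ ℤ.* (+ n₂))
  eQ₂ : Fin n₂ → Carrier
  eQ₂ γ = eN (a₂ ℤ.* Z γ ℤ.* Z γ ℤ.* (+ n₁))

  -- e(-B₁(γ,β)) = e(-2a₁γβ/n₁), similarly for B₂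
  eB₁ : Fin n₁ → Fin n₁ → Carrier
  eB₁ γ β = eN (ℤ.- ((+ 2) ℤ.* a₁ ℤ.* Z γ ℤ.* Z β ℤ.* (+ n₂)))
  eB₂ : Fin n₂ → Fin n₂ → Carrier
  eB₂ γ β = eN (ℤ.- ((+ 2) ℤ.* a₂ ℤ.* Z γ ℤ.* Z β ℤ.* (+ n₁)))

  -- Gauss sums G_i = Σ_γ e(Q_i(γ)) = √n_i · e(sign_i/8); hence the
  -- normalising factor e(-sign_i/8)/√n_i of ρ(S) equals G_i⁻¹.
  G₁ G₂ : Carrier
  G₁ = sumFin eQ₁
  G₂ = sumFin eQ₂

  Vec : Set c
  Vec = Fin n₁ → Fin n₂ → Carrier

  ρT : Vec → Vec
  ρT v γ₁ γ₂ = (eQ₁ γ₁ * eQ₂ γ₂) * v γ₁ γ₂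

  ρS : Vec → Vec
  ρS v β₁ β₂ = ((G₁ ⁻¹) * (G₂ ⁻¹)) *
    sumFin (λ γ₁ → sumFin (λ γ₂ → (eB₁ γ₁ β₁ * eB₂ γ₂ β₂) * v γ₁ γ₂))

  ρGen : Gen → Vec → Vec
  ρGen genS = ρS
  ρGen genT = ρT

  ρWord : List Gen → Vec → Vec
  ρWord []      v = v
  ρWord (g ∷ w) v = ρGen g (ρWord w v)

  Γ₀Invariant : ℕ → Vec → Set ℓ
  Γ₀Invariant p v = ∀ (w : List Gen) → InΓ₀ p w →
                    ∀ γ₁ γ₂ → ρWord w v γ₁ γ₂ ≈ v γ₁ γ₂

  IsZero : Vec → Set ℓ
  IsZero v = ∀ γ₁ γ₂ → v γ₁ γ₂ ≈ 0#

{-# OPTIONS --safe #-}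
module Submission where

-- Write N = p^(k₁+k₂), Q for the quadratic form and u for the Fourier transform of an invariant v.
-- Invariance under T confines v to the isotropic vectors (Q ≡ 0); invariance under S² and S T^p S,
-- together with Fourier inversion, confines u to the vectors with p Q ≡ 0, and there u equals
-- s = Σ v, because the bilinear form pairs the two sets into ℤ.  Invariance under S T^m S T^n S with
-- m n ≡ 1 (mod p) then gives s = (constant · s) · Σ_{pQ(β) ≡ 0} e(n Q(β)), and averaging over all n
-- prime to p turns this sum into N·#{Q ≡ 0} − (N/p)·#{p Q ≡ 0}.  Because the two terms of Q have
-- p-adic valuations of different parity when k₁ + k₂ is odd, both sets are products of p-power
-- lattices and the two counts agree.  So s = 0, hence σ² u = 0 for the normalising constant σ of
-- ρ(S), and v = 𝓕 (σ² u) = 0.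

open import Defs
open import Data.Nat.Primality using (Prime; prime⇒nonZero; prime⇒nonTrivial; prime⇒irreducible; euclidsLemma)
open import Data.Nat.Coprimality using (Coprime; coprime-Bézout)
import Data.Nat.GCD as GCD
open import Data.Sum using (inj₁; inj₂)

open import Level using (Level)
open import Algebra.Bundles using (CommutativeRing)
open import Data.Nat as ℕ using (ℕ; zero; suc; ⌈_/2⌉)
import Data.Nat.Properties as ℕP
import Data.Nat.DivMod as DivMod
open import Data.Integer as ℤ using (ℤ; +_; -[1+_]; _⊖_; _◃_; sign; ∣_∣)
import Data.Integer.Properties as ℤP
import Data.Integer.Tactic.RingSolver as ℤSolver
open import Data.Sign as Sign using (Sign)
open import Function using (_∘_)
open import Data.Fin as Fin using (Fin; toℕ)
import Data.Fin.Properties as FinP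
import Data.Nat.Divisibility as ℕ∣
open import Data.Maybe using (Maybe; just; nothing)
open import Data.Product using (Σ; _×_; _,_; proj₁; proj₂)
open import Data.Empty using (⊥-elim)
open import Relation.Nullary using (¬_; Dec; yes; no)
open import Relation.Binary.PropositionalEquality as ≡ using (_≡_; _≢_)

module IntegerRingSolver {c ℓ : Level} (R : CommutativeRing c ℓ) where
  open CommutativeRing R
  open import Algebra.Properties.Ring ring using (-‿distribˡ-*; -‿distribʳ-*)
  open import Algebra.Properties.AbelianGroup +-abelianGroup
    using (ε⁻¹≈ε; ⁻¹-involutive; ⁻¹-∙-comm)
  open import Algebra.Properties.CommutativeSemigroup +-commutativeSemigroup
    using () renaming (x∙yz≈y∙xz to x+[y+z]≈y+[x+z])
  open import Algebra.Properties.Semiring.Mult.TCOptimised semiring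
    using (1+×; ×-homo-+; ×1-homo-*) renaming (_×_ to _×′_)
  import Algebra.Solver.Ring.AlmostCommutativeRing as ACR
  open import Relation.Binary.Reasoning.Setoid setoid

  ofℤ : ℤ → Carrier
  ofℤ (+ n)    = n ×′ 1#
  ofℤ -[1+ n ] = - (suc n ×′ 1#)

  ofℤ-⊖ : ∀ m n → ofℤ (m ⊖ n) ≈ m ×′ 1# - n ×′ 1#
  ofℤ-⊖ zero    zero    = sym (trans (+-congˡ ε⁻¹≈ε) (+-identityʳ 0#))
  ofℤ-⊖ zero    (suc n) = sym (+-identityˡ _)
  ofℤ-⊖ (suc m) zero    = sym (trans (+-congˡ ε⁻¹≈ε) (+-identityʳ _))
  ofℤ-⊖ (suc m) (suc n) = begin
    ofℤ (suc m ⊖ suc n)                 ≡⟨ ≡.cong ofℤ (ℤP.[1+m]⊖[1+n]≡m⊖n m n) ⟩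
    ofℤ (m ⊖ n)                         ≈⟨ ofℤ-⊖ m n ⟩
    m ×′ 1# - n ×′ 1#                   ≈⟨ +-identityˡ _ ⟨
    0# + (m ×′ 1# - n ×′ 1#)            ≈⟨ +-congʳ (-‿inverseʳ 1#) ⟨
    (1# - 1#) + (m ×′ 1# - n ×′ 1#)     ≈⟨ +-assoc 1# (- 1#) _ ⟩
    1# + (- 1# + (m ×′ 1# - n ×′ 1#))   ≈⟨ +-congˡ (x+[y+z]≈y+[x+z] (- 1#) (m ×′ 1#) _) ⟩
    1# + (m ×′ 1# + (- 1# - n ×′ 1#))   ≈⟨ +-assoc 1# (m ×′ 1#) _ ⟨
    (1# + m ×′ 1#) + (- 1# - n ×′ 1#)
      ≈⟨ +-cong (sym (1+× m 1#)) (trans (⁻¹-∙-comm 1# _) (-‿cong (sym (1+× n 1#)))) ⟩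
    suc m ×′ 1# - suc n ×′ 1#           ∎

  ofℤ-neg : ∀ i → ofℤ (ℤ.- i) ≈ - ofℤ i
  ofℤ-neg (+ zero)  = sym ε⁻¹≈ε
  ofℤ-neg (+ suc n) = refl
  ofℤ-neg -[1+ n ]  = sym (⁻¹-involutive _)

  ofℤ-+ : ∀ i j → ofℤ (i ℤ.+ j) ≈ ofℤ i + ofℤ j
  ofℤ-+ -[1+ m ] -[1+ n ] = begin
    - (suc (suc (m ℕ.+ n)) ×′ 1#)          ≡⟨ ≡.cong (λ k → - (suc k ×′ 1#)) (ℕP.+-suc m n) ⟨
    - ((suc m ℕ.+ suc n) ×′ 1#)            ≈⟨ -‿cong (×-homo-+ 1# (suc m) (suc n)) ⟩
    - (suc m ×′ 1# + suc n ×′ 1#)          ≈⟨ ⁻¹-∙-comm _ _ ⟨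
    - (suc m ×′ 1#) + - (suc n ×′ 1#)      ∎
  ofℤ-+ -[1+ m ] (+ n)    = trans (ofℤ-⊖ n (suc m)) (+-comm _ _)
  ofℤ-+ (+ m)    -[1+ n ] = ofℤ-⊖ m (suc n)
  ofℤ-+ (+ m)    (+ n)    = ×-homo-+ 1# m n

  signed : Sign → Carrier → Carrier
  signed Sign.+ x = x
  signed Sign.- x = - x

  signed-cong : ∀ s {x y} → x ≈ y → signed s x ≈ signed s y
  signed-cong Sign.+ x≈y = x≈y
  signed-cong Sign.- x≈y = -‿cong x≈y

  signed-* : ∀ s t x y → signed (s Sign.* t) (x * y) ≈ signed s x * signed t y
  signed-* Sign.+ Sign.+ x y = refl
  signed-* Sign.+ Sign.- x y = -‿distribʳ-* x y
  signed-* Sign.- Sign.+ x y = -‿distribˡ-* x y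
  signed-* Sign.- Sign.- x y = begin
    x * y          ≈⟨ ⁻¹-involutive (x * y) ⟨
    - - (x * y)    ≈⟨ -‿cong (-‿distribʳ-* x y) ⟩
    - (x * - y)    ≈⟨ -‿distribˡ-* x (- y) ⟩
    - x * - y      ∎

  ofℤ-◃ : ∀ s n → ofℤ (s ◃ n) ≈ signed s (n ×′ 1#)
  ofℤ-◃ Sign.- zero    = sym ε⁻¹≈ε
  ofℤ-◃ Sign.+ zero    = refl
  ofℤ-◃ Sign.- (suc n) = refl
  ofℤ-◃ Sign.+ (suc n) = refl

  ofℤ-* : ∀ i j → ofℤ (i ℤ.* j) ≈ ofℤ i * ofℤ j
  ofℤ-* i j = begin
    ofℤ (sign i Sign.* sign j ◃ ∣ i ∣ ℕ.* ∣ j ∣)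
      ≈⟨ ofℤ-◃ (sign i Sign.* sign j) (∣ i ∣ ℕ.* ∣ j ∣) ⟩
    signed (sign i Sign.* sign j) ((∣ i ∣ ℕ.* ∣ j ∣) ×′ 1#)
      ≈⟨ signed-cong (sign i Sign.* sign j) (×1-homo-* ∣ i ∣ ∣ j ∣) ⟩
    signed (sign i Sign.* sign j) (∣ i ∣ ×′ 1# * ∣ j ∣ ×′ 1#)
      ≈⟨ signed-* (sign i) (sign j) _ _ ⟩
    signed (sign i) (∣ i ∣ ×′ 1#) * signed (sign j) (∣ j ∣ ×′ 1#)
      ≈⟨ *-cong (ofℤ-sign i) (ofℤ-sign j) ⟨
    ofℤ i * ofℤ j ∎
    where
    ofℤ-sign : ∀ i → ofℤ i ≈ signed (sign i) (∣ i ∣ ×′ 1#)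
    ofℤ-sign (+ n)    = refl
    ofℤ-sign -[1+ n ] = refl

  ofℤ-homomorphism : CommutativeRing.rawRing ℤP.+-*-commutativeRing
                       ACR.-Raw-AlmostCommutative⟶ ACR.fromCommutativeRing R
  ofℤ-homomorphism = record
    { ⟦_⟧    = ofℤ
    ; +-homo = ofℤ-+
    ; *-homo = ofℤ-*
    ; -‿homo = ofℤ-neg
    ; 0-homo = refl
    ; 1-homo = refl
    }

  ofℤ-≟ : ∀ i j → Maybe (ofℤ i ≈ ofℤ j)
  ofℤ-≟ i j with i ℤ.≟ j
  ... | yes ≡.refl = just refl
  ... | no _       = nothing

  open import Algebra.Solver.Ring _ (ACR.fromCommutativeRing R) ofℤ-homomorphism ofℤ-≟ public

module FieldProperties {c ℓ : Level} (F : CharZeroField c ℓ) where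
  open CharZeroField F
  open FieldOps F
  open import Algebra.Properties.CommutativeSemigroup *-commutativeSemigroup public
    using (interchange; x∙yz≈y∙xz; x∙yz≈z∙xy; xy∙z≈y∙xz)
  open import Algebra.Properties.CommutativeSemigroup +-commutativeSemigroup
    using () renaming (interchange to +-interchange)
  open import Algebra.Properties.Ring ring using ([y-z]x≈yx-zx)
  open IntegerRingSolver commRing public using (solve; _:=_; _:+_; _:*_; _:-_; con)
  open import Algebra.Properties.AbelianGroup +-abelianGroup using (ε⁻¹≈ε; ⁻¹-∙-comm; x∙y⁻¹≈ε⇒x≈y)
  open import Algebra.Properties.Semiring.Mult semiring using (×1-homo-*) renaming (_×_ to _×′_)
  open import Relation.Binary.Reasoning.Setoid setoid

  sumFin-cong : ∀ {n} {f g : Fin n → Carrier} → (∀ i → f i ≈ g i) → sumFin f ≈ sumFin g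
  sumFin-cong {zero}  f≈g = refl
  sumFin-cong {suc n} f≈g = +-cong (f≈g Fin.zero) (sumFin-cong (λ i → f≈g (Fin.suc i)))

  sumFin-zero : ∀ {n} {f : Fin n → Carrier} → (∀ i → f i ≈ 0#) → sumFin f ≈ 0#
  sumFin-zero {zero}  f≈0 = refl
  sumFin-zero {suc n} f≈0 =
    trans (+-cong (f≈0 Fin.zero) (sumFin-zero (λ i → f≈0 (Fin.suc i)))) (+-identityˡ 0#)

  sumFin-+ : ∀ {n} (f g : Fin n → Carrier) → sumFin (λ i → f i + g i) ≈ sumFin f + sumFin g
  sumFin-+ {zero}  f g = sym (+-identityˡ 0#)
  sumFin-+ {suc n} f g = trans (+-congˡ (sumFin-+ (λ i → f (Fin.suc i)) (λ i → g (Fin.suc i))))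
                               (+-interchange _ _ _ _)

  sumFin-neg : ∀ {n} (f : Fin n → Carrier) → sumFin (λ i → - f i) ≈ - sumFin f
  sumFin-neg {zero}  f = sym ε⁻¹≈ε
  sumFin-neg {suc n} f = trans (+-congˡ (sumFin-neg (λ i → f (Fin.suc i)))) (⁻¹-∙-comm _ _)

  sumFin-minus : ∀ {n} (f g : Fin n → Carrier) → sumFin (λ i → f i - g i) ≈ sumFin f - sumFin g
  sumFin-minus f g = trans (sumFin-+ f (λ i → - g i)) (+-congˡ (sumFin-neg g))

  *-distribˡ-sumFin : ∀ {n} x (f : Fin n → Carrier) → x * sumFin f ≈ sumFin (λ i → x * f i)
  *-distribˡ-sumFin {zero}  x f = zeroʳ x
  *-distribˡ-sumFin {suc n} x f =
    trans (distribˡ x _ _) (+-congˡ (*-distribˡ-sumFin x (λ i → f (Fin.suc i))))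

  *-distribʳ-sumFin : ∀ {n} x (f : Fin n → Carrier) → sumFin f * x ≈ sumFin (λ i → f i * x)
  *-distribʳ-sumFin x f =
    trans (*-comm _ x) (trans (*-distribˡ-sumFin x f) (sumFin-cong (λ i → *-comm x (f i))))

  sumFin-comm : ∀ {m n} (f : Fin m → Fin n → Carrier) →
                sumFin (λ i → sumFin (f i)) ≈ sumFin (λ j → sumFin (λ i → f i j))
  sumFin-comm {zero}  {n} f = sym (sumFin-zero {n} (λ _ → refl))
  sumFin-comm {suc m} f = trans (+-congˡ (sumFin-comm (λ i → f (Fin.suc i))))
                                (sym (sumFin-+ (f Fin.zero) _))

  sumFin-const : ∀ n x → sumFin {n} (λ _ → x) ≈ ofℕ commRing n * x
  sumFin-const zero    x = sym (zeroˡ x)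
  sumFin-const (suc n) x = begin
    x + sumFin {n} (λ _ → x)            ≈⟨ +-cong (sym (*-identityˡ x)) (sumFin-const n x) ⟩
    1# * x + ofℕ commRing n * x         ≈⟨ distribʳ x 1# _ ⟨
    ofℕ commRing (suc n) * x            ∎

  sumFin-delta : ∀ {n} {f : Fin n → Carrier} k → (∀ i → i ≢ k → f i ≈ 0#) → sumFin f ≈ f k
  sumFin-delta {suc n} Fin.zero    f≈0 =
    trans (+-congˡ (sumFin-zero (λ i → f≈0 (Fin.suc i) (λ ())))) (+-identityʳ _)
  sumFin-delta {suc n} (Fin.suc k) f≈0 =
    trans (+-cong (f≈0 Fin.zero (λ ()))
                  (sumFin-delta k (λ i i≢k → f≈0 (Fin.suc i) (i≢k ∘ FinP.suc-injective))))
          (+-identityˡ _)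

  sumRange : ℕ → (ℕ → Carrier) → Carrier
  sumRange n f = sumFin {n} (λ i → f (toℕ i))

  sumRange-cong : ∀ n {f g : ℕ → Carrier} → (∀ i → i ℕ.< n → f i ≈ g i) →
                  sumRange n f ≈ sumRange n g
  sumRange-cong n f≈g = sumFin-cong (λ i → f≈g (toℕ i) (FinP.toℕ<n i))

  sumRange-+ : ∀ m n f → sumRange (m ℕ.+ n) f ≈ sumRange m f + sumRange n (λ i → f (m ℕ.+ i))
  sumRange-+ zero    n f = sym (+-identityˡ _)
  sumRange-+ (suc m) n f =
    trans (+-congˡ (sumRange-+ m n (λ i → f (suc i)))) (sym (+-assoc _ _ _))

  sumRange-* : ∀ a b f →
               sumRange (a ℕ.* b) f ≈ sumRange a (λ q → sumRange b (λ r → f (q ℕ.* b ℕ.+ r)))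
  sumRange-* zero    b f = refl
  sumRange-* (suc a) b f = trans (sumRange-+ b (a ℕ.* b) f) (+-cong
    (sumRange-cong b {f} (λ r _ → refl))
    (trans (sumRange-* a b (λ i → f (b ℕ.+ i)))
           (sumRange-cong a (λ q _ → sumRange-cong b (λ r _ →
              reflexive (≡.cong f (≡.sym (ℕP.+-assoc b (q ℕ.* b) r))))))))

  pow-cong : ∀ {x y} n → x ≈ y → pow x n ≈ pow y n
  pow-cong zero    x≈y = refl
  pow-cong (suc n) x≈y = *-cong x≈y (pow-cong n x≈y)

  pow-+ : ∀ x m n → pow x (m ℕ.+ n) ≈ pow x m * pow x n
  pow-+ x zero    n = sym (*-identityˡ _)
  pow-+ x (suc m) n = trans (*-congˡ (pow-+ x m n)) (sym (*-assoc _ _ _))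

  pow-1# : ∀ n → pow 1# n ≈ 1#
  pow-1# zero    = refl
  pow-1# (suc n) = trans (*-identityˡ _) (pow-1# n)

  pow-* : ∀ x m n → pow x (m ℕ.* n) ≈ pow (pow x m) n
  pow-* x m zero    rewrite ℕP.*-zeroʳ m = refl
  pow-* x m (suc n) rewrite ℕP.*-suc m n =
    trans (pow-+ x m (m ℕ.* n)) (*-congˡ (pow-* x m n))

  pow-*-≈1 : ∀ x m n → pow x m ≈ 1# → pow x (n ℕ.* m) ≈ 1#
  pow-*-≈1 x m n xᵐ≈1 = begin
    pow x (n ℕ.* m)      ≡⟨ ≡.cong (pow x) (ℕP.*-comm n m) ⟩
    pow x (m ℕ.* n)      ≈⟨ pow-* x m n ⟩
    pow (pow x m) n      ≈⟨ pow-cong n xᵐ≈1 ⟩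
    pow 1# n             ≈⟨ pow-1# n ⟩
    1#                   ∎

  ofℕ-* : ∀ m n → ofℕ commRing (m ℕ.* n) ≈ ofℕ commRing m * ofℕ commRing n
  ofℕ-* m n = begin
    ofℕ commRing (m ℕ.* n)                ≈⟨ ofℕ≈×1 (m ℕ.* n) ⟩
    (m ℕ.* n) ×′ 1#                        ≈⟨ ×1-homo-* m n ⟩
    (m ×′ 1#) * (n ×′ 1#)                   ≈⟨ *-cong (ofℕ≈×1 m) (ofℕ≈×1 n) ⟨
    ofℕ commRing m * ofℕ commRing n       ∎
    where
    ofℕ≈×1 : ∀ n → ofℕ commRing n ≈ n ×′ 1#
    ofℕ≈×1 zero    = refl
    ofℕ≈×1 (suc n) = +-congˡ (ofℕ≈×1 n)

  ofℕ-nonzero : ∀ {n} → n ≢ 0 → ¬ (ofℕ commRing n ≈ 0#)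
  ofℕ-nonzero {zero}  n≢0 _ = n≢0 ≡.refl
  ofℕ-nonzero {suc n} _     = char0 n

  nonzero-cancelˡ : ∀ {x y} → ¬ (x ≈ 0#) → x * y ≈ 0# → y ≈ 0#
  nonzero-cancelˡ {x} {y} x≉0 xy≈0 = begin
    y                 ≈⟨ *-identityˡ y ⟨
    1# * y            ≈⟨ *-congʳ (inverseʳ x x≉0) ⟨
    (x * x ⁻¹) * y    ≈⟨ xy∙z≈y∙xz x (x ⁻¹) y ⟩
    x ⁻¹ * (x * y)    ≈⟨ *-congˡ xy≈0 ⟩
    x ⁻¹ * 0#         ≈⟨ zeroʳ _ ⟩
    0#                ∎

  x*y≈y⇒y≈0 : ∀ {x y} → x * y ≈ y → ¬ (x ≈ 1#) → y ≈ 0#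
  x*y≈y⇒y≈0 {x} {y} xy≈y x≉1 =
    nonzero-cancelˡ (x≉1 ∘ x∙y⁻¹≈ε⇒x≈y x 1#) (begin
      (x - 1#) * y    ≈⟨ [y-z]x≈yx-zx y x 1# ⟩
      x * y - 1# * y  ≈⟨ +-cong xy≈y (-‿cong (*-identityˡ y)) ⟩
      y - y           ≈⟨ -‿inverseʳ y ⟩
      0#              ∎)

  geometric-sum : ∀ r n → (r - 1#) * sumRange n (pow r) ≈ pow r n - 1#
  geometric-sum r zero    = trans (zeroʳ _) (sym (-‿inverseʳ 1#))
  geometric-sum r (suc n) = begin
    (r - 1#) * (1# + sumRange n (λ i → r * pow r i))
      ≈⟨ *-congˡ (+-congˡ (*-distribˡ-sumFin {n} r (λ i → pow r (toℕ i)))) ⟨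
    (r - 1#) * (1# + r * sumRange n (pow r))    ≈⟨ expand r (sumRange n (pow r)) ⟩
    r * ((r - 1#) * sumRange n (pow r)) + (r - 1#)
      ≈⟨ +-congʳ (*-congˡ (geometric-sum r n)) ⟩
    r * (pow r n - 1#) + (r - 1#)               ≈⟨ collect r (pow r n) ⟩
    r * pow r n - 1#                            ∎
    where
    one = con (ℤ.+ 1)
    expand : ∀ r s → (r - 1#) * (1# + r * s) ≈ r * ((r - 1#) * s) + (r - 1#)
    expand = solve 2 (λ r s → (r :- one) :* (one :+ r :* s) := r :* ((r :- one) :* s) :+ (r :- one)) refl
    collect : ∀ r t → r * (t - 1#) + (r - 1#) ≈ r * t - 1#
    collect = solve 2 (λ r t → r :* (t :- one) :+ (r :- one) := r :* t :- one) refl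

  geometric-sum-zero : ∀ r n → pow r n ≈ 1# → ¬ (r ≈ 1#) → sumRange n (pow r) ≈ 0#
  geometric-sum-zero r n rⁿ≈1 r≉1 = nonzero-cancelˡ (r≉1 ∘ x∙y⁻¹≈ε⇒x≈y r 1#)
    (trans (geometric-sum r n) (trans (+-congʳ rⁿ≈1) (-‿inverseʳ 1#)))

  indicator : ∀ {a} {A : Set a} → Dec A → Carrier
  indicator (yes _) = 1#
  indicator (no _)  = 0#

  indicator-yes : ∀ {a} {A : Set a} (d : Dec A) → A → indicator d ≈ 1#
  indicator-yes (yes _) _ = refl
  indicator-yes (no ¬a) a = ⊥-elim (¬a a)

  indicator-no : ∀ {a} {A : Set a} (d : Dec A) → ¬ A → indicator d ≈ 0#
  indicator-no (yes a) ¬a = ⊥-elim (¬a a)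
  indicator-no (no _)  _  = refl

  indicator-× : ∀ {a b d} {A : Set a} {B : Set b} {D : Set d}
                (dA : Dec A) (dB : Dec B) (dD : Dec D) →
                (D → A × B) → (A → B → D) → indicator dD ≈ indicator dA * indicator dB
  indicator-× dA dB (yes d) to from =
    sym (trans (*-cong (indicator-yes dA (proj₁ (to d))) (indicator-yes dB (proj₂ (to d))))
               (*-identityˡ 1#))
  indicator-× (yes a) (yes b) (no ¬d) to from = ⊥-elim (¬d (from a b))
  indicator-× (yes a) (no _)  (no ¬d) to from = sym (zeroʳ _)
  indicator-× (no _)  dB      (no ¬d) to from = sym (zeroˡ _)

  sum² : ∀ {m n} → (Fin m → Fin n → Carrier) → Carrier
  sum² f = sumFin (λ x → sumFin (f x))

  sum²-cong : ∀ {m n} {f g : Fin m → Fin n → Carrier} → (∀ x y → f x y ≈ g x y) → sum² f ≈ sum² g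
  sum²-cong f≈g = sumFin-cong (λ x → sumFin-cong (f≈g x))

  sum²-zero : ∀ {m n} {f : Fin m → Fin n → Carrier} → (∀ x y → f x y ≈ 0#) → sum² f ≈ 0#
  sum²-zero f≈0 = sumFin-zero (λ x → sumFin-zero (f≈0 x))

  *-distribˡ-sum² : ∀ {m n} k (f : Fin m → Fin n → Carrier) → k * sum² f ≈ sum² (λ x y → k * f x y)
  *-distribˡ-sum² {m} k f = trans (*-distribˡ-sumFin {m} k _) (sumFin-cong (λ x → *-distribˡ-sumFin k (f x)))

  sum²-minus : ∀ {m n} (f g : Fin m → Fin n → Carrier) → sum² (λ x y → f x y - g x y) ≈ sum² f - sum² g
  sum²-minus {m} f g = trans (sumFin-cong (λ x → sumFin-minus (f x) (g x))) (sumFin-minus {m} _ _)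

  sum²-product : ∀ {m n} (f : Fin m → Carrier) (g : Fin n → Carrier) →
                 sum² (λ x y → f x * g y) ≈ sumFin f * sumFin g
  sum²-product f g = trans (sumFin-cong (λ x → sym (*-distribˡ-sumFin (f x) g)))
                           (sym (*-distribʳ-sumFin (sumFin g) f))

  sum²-comm : ∀ {a b m n} (f : Fin a → Fin b → Fin m → Fin n → Carrier) →
              sum² (λ i j → sum² (f i j)) ≈ sum² (λ x y → sum² (λ i j → f i j x y))
  sum²-comm f = begin
    sum² (λ i j → sum² (f i j))
      ≈⟨ sumFin-cong (λ i → sumFin-comm (λ j x → sumFin (f i j x))) ⟩
    sumFin (λ i → sumFin (λ x → sumFin (λ j → sumFin (f i j x))))
      ≈⟨ sumFin-cong (λ i → sumFin-cong (λ x → sumFin-comm (λ j y → f i j x y))) ⟩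
    sumFin (λ i → sumFin (λ x → sumFin (λ y → sumFin (λ j → f i j x y))))
      ≈⟨ sumFin-comm (λ i x → sumFin (λ y → sumFin (λ j → f i j x y))) ⟩
    sumFin (λ x → sumFin (λ i → sumFin (λ y → sumFin (λ j → f i j x y))))
      ≈⟨ sumFin-cong (λ x → sumFin-comm (λ i y → sumFin (λ j → f i j x y))) ⟩
    sum² (λ x y → sum² (λ i j → f i j x y)) ∎

  count-multiples : ∀ a b .{{_ : ℕ.NonZero b}} →
                    sumRange (a ℕ.* b) (λ y → indicator (b ℕ∣.∣? y)) ≈ ofℕ commRing a
  count-multiples a b = ≡.subst (λ b → sumRange (a ℕ.* b) (λ y → indicator (b ℕ∣.∣? y)) ≈ ofℕ commRing a)
                                (ℕP.suc-pred b) (count-multiples-suc (ℕ.pred b))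
    where
    count-multiples-suc : ∀ b →
      sumRange (a ℕ.* suc b) (λ y → indicator (suc b ℕ∣.∣? y)) ≈ ofℕ commRing a
    count-multiples-suc b = begin
      sumRange (a ℕ.* suc b) χ                                       ≈⟨ sumRange-* a (suc b) χ ⟩
      sumRange a (λ q → sumRange (suc b) (λ r → χ (q ℕ.* suc b ℕ.+ r)))
                                                                     ≈⟨ sumRange-cong a (λ q _ → one-per-block q) ⟩
      sumRange a (λ _ → 1#)                                          ≈⟨ sumFin-const a 1# ⟩
      ofℕ commRing a * 1#                                            ≈⟨ *-identityʳ _ ⟩
      ofℕ commRing a                                                 ∎
      where
      χ : ℕ → Carrier
      χ y = indicator (suc b ℕ∣.∣? y)
      ∤ : ∀ q r → r ℕ.< b → ¬ (suc b ℕ∣.∣ q ℕ.* suc b ℕ.+ suc r)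
      ∤ q r r<b b∣ = ℕP.<⇒≱ (ℕ.s≤s r<b) (ℕ∣.∣⇒≤ (ℕ∣.∣m+n∣m⇒∣n b∣ (ℕ∣.n∣m*n q)))
      one-per-block : ∀ q → sumRange (suc b) (λ r → χ (q ℕ.* suc b ℕ.+ r)) ≈ 1#
      one-per-block q = trans
        (+-cong (indicator-yes (suc b ℕ∣.∣? _)
                   (≡.subst (suc b ℕ∣.∣_) (≡.sym (ℕP.+-identityʳ _)) (ℕ∣.n∣m*n q)))
                (trans (sumRange-cong b (λ r r<b → indicator-no (suc b ℕ∣.∣? _) (∤ q r r<b)))
                       (sumFin-zero {b} (λ _ → refl))))
        (+-identityʳ 1#)

ℤ-as-⊖ : ∀ z → Σ ℕ (λ a → Σ ℕ (λ b → z ≡ a ⊖ b))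
ℤ-as-⊖ (+ n)    = n , 0 , ≡.refl
ℤ-as-⊖ -[1+ n ] = 0 , suc n , ≡.refl

⊖-+-⊖ : ∀ a b a′ b′ → (a ⊖ b) ℤ.+ (a′ ⊖ b′) ≡ (a ℕ.+ a′) ⊖ (b ℕ.+ b′)
⊖-+-⊖ a b a′ b′ = ≡.trans
  (≡.cong₂ ℤ._+_ (≡.sym (ℤP.m-n≡m⊖n a b)) (≡.sym (ℤP.m-n≡m⊖n a′ b′)))
  (≡.trans (regroup (+ a) (+ b) (+ a′) (+ b′)) (ℤP.m-n≡m⊖n (a ℕ.+ a′) (b ℕ.+ b′)))
  where
  regroup : ∀ a b a′ b′ → (a ℤ.- b) ℤ.+ (a′ ℤ.- b′) ≡ (a ℤ.+ a′) ℤ.- (b ℤ.+ b′)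
  regroup = ℤSolver.solve-∀

pos-+-*-≡ : ∀ a b c d e → a ℕ.+ b ℕ.* c ≡ d ℕ.* e → + a ℤ.+ + b ℤ.* + c ≡ + d ℤ.* + e
pos-+-*-≡ a b c d e eq = ≡.trans (≡.cong (λ t → + a ℤ.+ t) (≡.sym (ℤP.pos-* b c)))
  (≡.trans (≡.sym (ℤP.pos-+ a (b ℕ.* c))) (≡.trans (≡.cong +_ eq) (ℤP.pos-* d e)))

module RootOfUnity {c ℓ : Level} (F : CharZeroField c ℓ) (ζ : CharZeroField.Carrier F)
                   (N : ℕ) .{{_ : ℕ.NonZero N}} (ζ-primitive : FieldOps.IsPrimitiveRoot F ζ N) where
  open CharZeroField F
  open FieldOps F
  open FieldProperties F
  open import Algebra.Properties.AbelianGroup +-abelianGroup using (xyx⁻¹≈y)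
  open import Data.Integer.Divisibility.Signed as ℤ∣ using (_∣_; _∣?_; divides)
  import Data.Integer.DivMod as ℤDivMod
  open import Relation.Binary.Reasoning.Setoid setoid

  ζ⁻¹ : Carrier
  ζ⁻¹ = pow ζ (N ℕ.∸ 1)

  e : ℤ → Carrier
  e (+ m)    = pow ζ m
  e -[1+ m ] = pow ζ⁻¹ (suc m)

  ζᴺ≈1 : pow ζ N ≈ 1#
  ζᴺ≈1 = proj₁ ζ-primitive

  ζ*ζ⁻¹≈1 : ζ * ζ⁻¹ ≈ 1#
  ζ*ζ⁻¹≈1 = trans (reflexive (≡.cong (pow ζ) (ℕP.suc-pred N))) ζᴺ≈1

  e-⊖ : ∀ a b → e (a ⊖ b) ≈ pow ζ a * pow ζ⁻¹ b
  e-⊖ a       zero    = sym (*-identityʳ _)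
  e-⊖ zero    (suc b) = sym (*-identityˡ _)
  e-⊖ (suc a) (suc b) = begin
    e (suc a ⊖ suc b)                   ≡⟨ ≡.cong e (ℤP.[1+m]⊖[1+n]≡m⊖n a b) ⟩
    e (a ⊖ b)                           ≈⟨ e-⊖ a b ⟩
    pow ζ a * pow ζ⁻¹ b                 ≈⟨ *-identityˡ _ ⟨
    1# * (pow ζ a * pow ζ⁻¹ b)          ≈⟨ *-congʳ ζ*ζ⁻¹≈1 ⟨
    (ζ * ζ⁻¹) * (pow ζ a * pow ζ⁻¹ b)   ≈⟨ interchange _ _ _ _ ⟩
    pow ζ (suc a) * pow ζ⁻¹ (suc b)     ∎

  e-+ : ∀ x y → e (x ℤ.+ y) ≈ e x * e y
  e-+ x y with ℤ-as-⊖ x | ℤ-as-⊖ y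
  ... | a , b , ≡.refl | a′ , b′ , ≡.refl = begin
    e ((a ⊖ b) ℤ.+ (a′ ⊖ b′))                          ≡⟨ ≡.cong e (⊖-+-⊖ a b a′ b′) ⟩
    e ((a ℕ.+ a′) ⊖ (b ℕ.+ b′))                        ≈⟨ e-⊖ (a ℕ.+ a′) (b ℕ.+ b′) ⟩
    pow ζ (a ℕ.+ a′) * pow ζ⁻¹ (b ℕ.+ b′)              ≈⟨ *-cong (pow-+ ζ a a′) (pow-+ ζ⁻¹ b b′) ⟩
    (pow ζ a * pow ζ a′) * (pow ζ⁻¹ b * pow ζ⁻¹ b′)    ≈⟨ interchange _ _ _ _ ⟩
    (pow ζ a * pow ζ⁻¹ b) * (pow ζ a′ * pow ζ⁻¹ b′)    ≈⟨ *-cong (e-⊖ a b) (e-⊖ a′ b′) ⟨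
    e (a ⊖ b) * e (a′ ⊖ b′)                            ∎

  e-≈1-neg : ∀ {w} → e w ≈ 1# → e (ℤ.- w) ≈ 1#
  e-≈1-neg {w} eʷ≈1 = begin
    e (ℤ.- w)              ≈⟨ *-identityʳ _ ⟨
    e (ℤ.- w) * 1#         ≈⟨ *-congˡ eʷ≈1 ⟨
    e (ℤ.- w) * e w        ≈⟨ e-+ (ℤ.- w) w ⟨
    e (ℤ.- w ℤ.+ w)        ≡⟨ ≡.cong e (ℤP.+-inverseˡ w) ⟩
    1#                     ∎

  e-multiple : ∀ q → e (q ℤ.* + N) ≈ 1#
  e-multiple (+ a) = trans (reflexive (≡.cong e (≡.sym (ℤP.pos-* a N))))
                           (pow-*-≈1 ζ N a ζᴺ≈1)
  e-multiple -[1+ a ] =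
    trans (reflexive (≡.cong e (≡.trans (≡.sym (ℤP.neg-distribˡ-* (+ suc a) (+ N)))
                                        (≡.cong ℤ.-_ (≡.sym (ℤP.pos-* (suc a) N))))))
          (e-≈1-neg {+ (suc a ℕ.* N)} (pow-*-≈1 ζ N (suc a) ζᴺ≈1))

  ∣⇒e≈1 : ∀ {z} → + N ∣ z → e z ≈ 1#
  ∣⇒e≈1 (divides q ≡.refl) = e-multiple q

  e≈1⇒∣ : ∀ {z} → e z ≈ 1# → + N ∣ z
  e≈1⇒∣ {z} eᶻ≈1 = divides q (≡.trans z≡r+qN
    (≡.trans (≡.cong (λ t → + t ℤ.+ q ℤ.* + N) r≡0) (ℤP.+-identityˡ (q ℤ.* + N))))
    where
    r = z ℤDivMod.%ℕ N
    q = z ℤDivMod./ℕ N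
    z≡r+qN : z ≡ + r ℤ.+ q ℤ.* + N
    z≡r+qN = ℤDivMod.a≡a%ℕn+[a/ℕn]*n z N
    ζʳ≈1 : pow ζ r ≈ 1#
    ζʳ≈1 = begin
      e (+ r)                       ≈⟨ *-identityʳ _ ⟨
      e (+ r) * 1#                  ≈⟨ *-congˡ (e-multiple q) ⟨
      e (+ r) * e (q ℤ.* + N)       ≈⟨ e-+ (+ r) (q ℤ.* + N) ⟨
      e (+ r ℤ.+ q ℤ.* + N)         ≡⟨ ≡.cong e z≡r+qN ⟨
      e z                           ≈⟨ eᶻ≈1 ⟩
      1#                            ∎
    r≡0 : r ≡ 0
    r≡0 with r | ℤDivMod.n%ℕd<d z N | ζʳ≈1
    ... | zero  | _   | _    = ≡.refl
    ... | suc _ | r<N | ζʳ≈1 = ⊥-elim (proj₂ ζ-primitive _ (ℕ.s≤s ℕ.z≤n) r<N ζʳ≈1)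

  e-*ℕ : ∀ k z → e (+ k ℤ.* z) ≈ pow (e z) k
  e-*ℕ zero    z = reflexive (≡.cong e (ℤP.*-zeroˡ z))
  e-*ℕ (suc k) z = begin
    e (+ suc k ℤ.* z)          ≡⟨ ≡.cong e (ℤP.suc-* (+ k) z) ⟩
    e (z ℤ.+ + k ℤ.* z)        ≈⟨ e-+ z (+ k ℤ.* z) ⟩
    e z * e (+ k ℤ.* z)        ≈⟨ *-congˡ (e-*ℕ k z) ⟩
    e z * pow (e z) k          ∎

  character-sum-zero : ∀ n z → ¬ (+ N ∣ z) → + N ∣ + n ℤ.* z →
                       sumRange n (λ i → e (+ i ℤ.* z)) ≈ 0#
  character-sum-zero n z N∤z N∣nz = begin
    sumRange n (λ i → e (+ i ℤ.* z))   ≈⟨ sumRange-cong n (λ i _ → e-*ℕ i z) ⟩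
    sumRange n (pow (e z))              ≈⟨ geometric-sum-zero (e z) n eᶻⁿ≈1 (N∤z ∘ e≈1⇒∣) ⟩
    0#                                  ∎
    where
    eᶻⁿ≈1 : pow (e z) n ≈ 1#
    eᶻⁿ≈1 = trans (sym (e-*ℕ n z)) (∣⇒e≈1 N∣nz)

  character-sum : ∀ z → sumRange N (λ n → e (+ n ℤ.* z)) ≈ ofℕ commRing N * indicator (+ N ∣? z)
  character-sum z with + N ∣? z
  ... | yes N∣z = trans (sumRange-cong N (λ n _ → ∣⇒e≈1 (ℤ∣.∣n⇒∣m*n (+ n) N∣z))) (sumFin-const N 1#)
  ... | no  N∤z = trans (character-sum-zero N z N∤z (ℤ∣.∣m⇒∣m*n z ℤ∣.∣-refl)) (sym (zeroʳ _))

  -- i p + suc r runs over the n < N prime to p; the M multiples of p account for the − M.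
  character-sum-units : ∀ M p d z → p ≡ suc d → N ≡ M ℕ.* p → + N ∣ + p ℤ.* z →
    sumRange M (λ i → sumRange d (λ r → e (+ (i ℕ.* p ℕ.+ suc r) ℤ.* z))) ≈
    ofℕ commRing N * indicator (+ N ∣? z) - ofℕ commRing M
  character-sum-units M p d z ≡.refl N≡Mp N∣pz = begin
    units                                                    ≈⟨ xyx⁻¹≈y (ofℕ commRing M) units ⟨
    (ofℕ commRing M + units) - ofℕ commRing M                ≈⟨ +-congʳ all-residues ⟨
    sumRange N g - ofℕ commRing M                            ≈⟨ +-congʳ (character-sum z) ⟩
    ofℕ commRing N * indicator (+ N ∣? z) - ofℕ commRing M   ∎
    where
    g : ℕ → Carrier
    g n = e (+ n ℤ.* z)
    units = sumRange M (λ i → sumRange d (λ r → g (i ℕ.* p ℕ.+ suc r)))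
    g[ip]≈1 : ∀ i → g (i ℕ.* p ℕ.+ 0) ≈ 1#
    g[ip]≈1 i = ∣⇒e≈1 (≡.subst (+ N ∣_) ip*z (ℤ∣.∣n⇒∣m*n (+ i) N∣pz))
      where
      ip*z : + i ℤ.* (+ p ℤ.* z) ≡ + (i ℕ.* p ℕ.+ 0) ℤ.* z
      ip*z = ≡.trans (≡.sym (ℤP.*-assoc (+ i) (+ p) z))
        (≡.cong (ℤ._* z) (≡.trans (≡.sym (ℤP.pos-* i p)) (≡.cong +_ (≡.sym (ℕP.+-identityʳ _)))))
    all-residues : sumRange N g ≈ ofℕ commRing M + units
    all-residues = begin
      sumRange N g                                                       ≡⟨ ≡.cong (λ n → sumRange n g) N≡Mp ⟩
      sumRange (M ℕ.* p) g                                               ≈⟨ sumRange-* M p g ⟩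
      sumRange M (λ i → g (i ℕ.* p ℕ.+ 0) + sumRange d (λ r → g (i ℕ.* p ℕ.+ suc r)))
        ≈⟨ sumRange-cong M (λ i _ → +-congʳ {sumRange d (λ r → g (i ℕ.* p ℕ.+ suc r))} (g[ip]≈1 i)) ⟩
      sumRange M (λ i → 1# + sumRange d (λ r → g (i ℕ.* p ℕ.+ suc r)))
        ≈⟨ sumFin-+ {M} (λ _ → 1#) (λ i → sumRange d (λ r → g (toℕ i ℕ.* p ℕ.+ suc r))) ⟩
      sumRange M (λ _ → 1#) + units
        ≈⟨ +-congʳ (trans (sumFin-const M 1#) (*-identityʳ _)) ⟩
      ofℕ commRing M + units                                             ∎

data Odd : ℕ → Set where
  odd-1  : Odd 1
  odd-+2 : ∀ {n} → Odd n → Odd (suc (suc n))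

%2≡1⇒Odd : ∀ n → n ℕ.% 2 ≡ 1 → Odd n
%2≡1⇒Odd (suc zero)    _    = odd-1
%2≡1⇒Odd (suc (suc n)) n%2 =
  odd-+2 (%2≡1⇒Odd n (≡.trans (≡.sym (DivMod.[m+n]%n≡m%n n 2))
                              (≡.trans (≡.cong (ℕ._% 2) (ℕP.+-comm n 2)) n%2)))

Odd-+-comm : ∀ {m n} → Odd (m ℕ.+ n) → Odd (n ℕ.+ m)
Odd-+-comm {m} {n} = ≡.subst Odd (ℕP.+-comm m n)

⌈suc/2⌉+⌈/2⌉≡suc : ∀ n → ⌈ suc n /2⌉ ℕ.+ ⌈ n /2⌉ ≡ suc n
⌈suc/2⌉+⌈/2⌉≡suc n = ≡.cong suc (ℕP.⌊n/2⌋+⌈n/2⌉≡n n)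

n≤⌈n/2⌉+⌈n/2⌉ : ∀ n → n ℕ.≤ ⌈ n /2⌉ ℕ.+ ⌈ n /2⌉
n≤⌈n/2⌉+⌈n/2⌉ n = ≡.subst (ℕ._≤ ⌈ n /2⌉ ℕ.+ ⌈ n /2⌉) (ℕP.⌊n/2⌋+⌈n/2⌉≡n n)
                    (ℕP.+-monoˡ-≤ ⌈ n /2⌉ (ℕP.⌊n/2⌋≤⌈n/2⌉ n))

⌈suc/2⌉-sum-Odd : ∀ a b → Odd (a ℕ.+ b) →
                  ⌈ suc a /2⌉ ℕ.+ ⌈ suc b /2⌉ ≡ suc (⌈ a /2⌉ ℕ.+ ⌈ b /2⌉)
⌈suc/2⌉-sum-Odd zero          b odd = ≡.cong suc (⌈suc/2⌉≡⌈/2⌉ b odd)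
  where
  ⌈suc/2⌉≡⌈/2⌉ : ∀ b → Odd b → ⌈ suc b /2⌉ ≡ ⌈ b /2⌉
  ⌈suc/2⌉≡⌈/2⌉ _ odd-1        = ≡.refl
  ⌈suc/2⌉≡⌈/2⌉ _ (odd-+2 odd) = ≡.cong suc (⌈suc/2⌉≡⌈/2⌉ _ odd)
⌈suc/2⌉-sum-Odd (suc zero)    b odd = ≡.cong suc (⌈suc/2⌉≡suc⌈/2⌉ b odd)
  where
  ⌈suc/2⌉≡suc⌈/2⌉ : ∀ b → Odd (suc b) → ⌈ suc b /2⌉ ≡ suc ⌈ b /2⌉
  ⌈suc/2⌉≡suc⌈/2⌉ zero    _            = ≡.refl
  ⌈suc/2⌉≡suc⌈/2⌉ (suc (suc b)) (odd-+2 odd) = ≡.cong suc (⌈suc/2⌉≡suc⌈/2⌉ b odd)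
⌈suc/2⌉-sum-Odd (suc (suc a)) b (odd-+2 odd) = ≡.cong suc (⌈suc/2⌉-sum-Odd a b odd)

module PrimePowerDivisibility (p : ℕ) (p-prime : Prime p) where
  open import Data.Nat using (_^_; _*_; _+_; _∸_)
  open ℕ∣ using (_∣_; divides)
  open import Data.Integer.Divisibility.Signed as ℤ∣ using () renaming (_∣_ to _∣ℤ_)
  import Data.Nat.Tactic.RingSolver as ℕSolver
  open GCD using (module Bézout)

  instance
    p≢0 : ℕ.NonZero p
    p≢0 = prime⇒nonZero p-prime

  coprime⇒∤ : ∀ {a} → Coprime a p → ¬ (p ∣ a)
  coprime⇒∤ a⊥p p∣a =
    ℕP.<⇒≢ (ℕ.nonTrivial⇒n>1 p {{prime⇒nonTrivial p-prime}}) (≡.sym (a⊥p (p∣a , ℕ∣.∣-refl)))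

  ∣-square⇒∣ : ∀ x → p ∣ x * x → p ∣ x
  ∣-square⇒∣ x p∣x² with euclidsLemma x x p-prime p∣x²
  ... | inj₁ p∣x = p∣x
  ... | inj₂ p∣x = p∣x

  ^∣-cancel-coprime : ∀ k u z → ¬ (p ∣ u) → p ^ k ∣ u * z → p ^ k ∣ z
  ^∣-cancel-coprime zero    u z _   _ = ℕ∣.1∣ z
  ^∣-cancel-coprime (suc k) u z p∤u pᵏ⁺¹∣uz
    with euclidsLemma u z p-prime (ℕ∣.∣-trans (ℕ∣.m∣m*n (p ^ k)) pᵏ⁺¹∣uz)
  ... | inj₁ p∣u = ⊥-elim (p∤u p∣u)
  ... | inj₂ (divides q ≡.refl) =
    ≡.subst (p ^ suc k ∣_) (ℕP.*-comm p q) (ℕ∣.*-monoʳ-∣ p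
      (^∣-cancel-coprime k u q p∤u (ℕ∣.*-cancelˡ-∣ p
        (≡.subst (p * p ^ k ∣_) (rearrange u q p) pᵏ⁺¹∣uz))))
    where
    rearrange : ∀ u q p → u * (q * p) ≡ p * (u * q)
    rearrange = ℕSolver.solve-∀

  ^∣-square⇒^⌈/2⌉∣ : ∀ r x → p ^ r ∣ x * x → p ^ ⌈ r /2⌉ ∣ x
  ^∣-square⇒^⌈/2⌉∣ zero          x _ = ℕ∣.1∣ x
  ^∣-square⇒^⌈/2⌉∣ (suc zero)    x p∣x² =
    ≡.subst (_∣ x) (≡.sym (ℕP.*-identityʳ p))
      (∣-square⇒∣ x (≡.subst (_∣ x * x) (ℕP.*-identityʳ p) p∣x²))
  ^∣-square⇒^⌈/2⌉∣ (suc (suc r)) x pʳ⁺²∣x²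
    with ∣-square⇒∣ x (ℕ∣.∣-trans (ℕ∣.m∣m*n (p ^ suc r)) pʳ⁺²∣x²)
  ... | divides q ≡.refl =
    ≡.subst (p ^ ⌈ suc (suc r) /2⌉ ∣_) (ℕP.*-comm p q) (ℕ∣.*-monoʳ-∣ p
      (^∣-square⇒^⌈/2⌉∣ r q (ℕ∣.*-cancelˡ-∣ p (ℕ∣.*-cancelˡ-∣ p
        (≡.subst (p * (p * p ^ r) ∣_) (rearrange q p) pʳ⁺²∣x²)))))
    where
    rearrange : ∀ q p → q * p * (q * p) ≡ p * (p * (q * q))
    rearrange = ℕSolver.solve-∀

  ^-monoʳ-∣ : ∀ {a b} → a ℕ.≤ b → p ^ a ∣ p ^ b
  ^-monoʳ-∣ {a} {b} a≤b = divides (p ^ (b ∸ a))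
    (≡.trans (≡.cong (p ^_) (≡.sym (ℕP.m∸n+n≡m a≤b))) (ℕP.^-distribˡ-+-* p (b ∸ a) a))

  ^⌈/2⌉∣⇒^∣-square : ∀ r x → p ^ ⌈ r /2⌉ ∣ x → p ^ r ∣ x * x
  ^⌈/2⌉∣⇒^∣-square r x p^⌈r/2⌉∣x = ℕ∣.∣-trans (^-monoʳ-∣ (n≤⌈n/2⌉+⌈n/2⌉ r))
    (≡.subst (_∣ x * x) (≡.sym (ℕP.^-distribˡ-+-* p ⌈ r /2⌉ ⌈ r /2⌉))
      (ℕ∣.*-pres-∣ p^⌈r/2⌉∣x p^⌈r/2⌉∣x))

  pℤ^ : ℕ → ℤ
  pℤ^ j = + (p ^ j)

  term : ℤ → ℕ → ℕ → ℤ
  term A x s = A ℤ.* + (x * x * p ^ s)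

  pℤ^-suc : ∀ j → pℤ^ (suc j) ≡ + p ℤ.* pℤ^ j
  pℤ^-suc j = ℤP.pos-* p (p ^ j)

  ∣-cancel-p : ∀ j Z → pℤ^ (suc j) ∣ℤ + p ℤ.* Z → pℤ^ j ∣ℤ Z
  ∣-cancel-p j Z h = ℤ∣.*-cancelˡ-∣ (+ p) (≡.subst (_∣ℤ + p ℤ.* Z) (pℤ^-suc j) h)

  ∣-mul-p : ∀ j Z → pℤ^ j ∣ℤ Z → pℤ^ (suc j) ∣ℤ + p ℤ.* Z
  ∣-mul-p j Z h = ≡.subst (_∣ℤ + p ℤ.* Z) (≡.sym (pℤ^-suc j)) (ℤ∣.*-monoʳ-∣ (+ p) h)

  term-suc : ∀ A x s → term A x (suc s) ≡ + p ℤ.* term A x s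
  term-suc A x s = ≡.trans (≡.cong (λ t → A ℤ.* + t) (rearrangeℕ x p (p ^ s)))
    (≡.trans (≡.cong (A ℤ.*_) (ℤP.pos-* p (x * x * p ^ s))) (rearrangeℤ A (+ p) _))
    where
    rearrangeℕ : ∀ x p m → x * x * (p * m) ≡ p * (x * x * m)
    rearrangeℕ = ℕSolver.solve-∀
    rearrangeℤ : ∀ A P M → A ℤ.* (P ℤ.* M) ≡ P ℤ.* (A ℤ.* M)
    rearrangeℤ = ℤSolver.solve-∀

  term-p* : ∀ A q → term A (q * p) 0 ≡ + p ℤ.* term A q 1
  term-p* A q = ≡.trans (≡.cong (λ t → A ℤ.* + t) (rearrangeℕ q p))
    (≡.trans (≡.cong (A ℤ.*_) (ℤP.pos-* p (q * q * (p * 1)))) (rearrangeℤ A (+ p) _))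
    where
    rearrangeℕ : ∀ q p → q * p * (q * p) * 1 ≡ p * (q * q * (p * 1))
    rearrangeℕ = ℕSolver.solve-∀
    rearrangeℤ : ∀ A P M → A ℤ.* (P ℤ.* M) ≡ P ℤ.* (A ℤ.* M)
    rearrangeℤ = ℤSolver.solve-∀

  -- The p-adic valuations of the two terms have different parities, so they cannot cancel.
  mutual
    ∣-sum⇒∣-terms : ∀ j s t A B x y → ¬ (p ∣ ∣ A ∣) → ¬ (p ∣ ∣ B ∣) → Odd (s + t) →
                    pℤ^ j ∣ℤ term A x s ℤ.+ term B y t →
                    (pℤ^ j ∣ℤ term A x s) × (pℤ^ j ∣ℤ term B y t)
    ∣-sum⇒∣-terms zero    s       t       A B x y _   _   _   _ =
      ℤ∣.∣ᵤ⇒∣ (ℕ∣.1∣ _) , ℤ∣.∣ᵤ⇒∣ (ℕ∣.1∣ _)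
    ∣-sum⇒∣-terms (suc j) zero    t       A B x y p∤A p∤B odd h =
      ∣-sum⇒∣-terms-unit j t A B x y p∤A p∤B odd h
    ∣-sum⇒∣-terms (suc j) (suc s) zero    A B x y p∤A p∤B odd h =
      let (hB , hA) = ∣-sum⇒∣-terms-unit j (suc s) B A y x p∤B p∤A
                        (≡.subst Odd (ℕP.+-identityʳ (suc s)) odd)
                        (≡.subst (pℤ^ (suc j) ∣ℤ_) (ℤP.+-comm (term A x (suc s)) (term B y 0)) h)
      in hA , hB
    ∣-sum⇒∣-terms (suc j) (suc s) (suc t) A B x y p∤A p∤B odd h
      with ≡.subst Odd (≡.cong suc (ℕP.+-suc s t)) odd
    ... | odd-+2 odd′ =
      let (hA , hB) = ∣-sum⇒∣-terms j s t A B x y p∤A p∤B odd′ (∣-cancel-p j _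
                        (≡.subst (pℤ^ (suc j) ∣ℤ_)
                          (≡.trans (≡.cong₂ ℤ._+_ (term-suc A x s) (term-suc B y t))
                                   (≡.sym (ℤP.*-distribˡ-+ (+ p) _ _))) h))
      in ≡.subst (pℤ^ (suc j) ∣ℤ_) (≡.sym (term-suc A x s)) (∣-mul-p j _ hA) ,
         ≡.subst (pℤ^ (suc j) ∣ℤ_) (≡.sym (term-suc B y t)) (∣-mul-p j _ hB)

    ∣-sum⇒∣-terms-unit : ∀ j t A B x y → ¬ (p ∣ ∣ A ∣) → ¬ (p ∣ ∣ B ∣) → Odd t →
                         pℤ^ (suc j) ∣ℤ term A x 0 ℤ.+ term B y t →
                         (pℤ^ (suc j) ∣ℤ term A x 0) × (pℤ^ (suc j) ∣ℤ term B y t)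
    ∣-sum⇒∣-terms-unit j (suc t) A B x y p∤A p∤B odd h with p∣x
      where
      p∣termB : + p ∣ℤ term B y (suc t)
      p∣termB = ≡.subst (+ p ∣ℤ_) (≡.sym (term-suc B y t)) (ℤ∣.∣m⇒∣m*n _ ℤ∣.∣-refl)
      p∣p^[1+j] : + p ∣ℤ pℤ^ (suc j)
      p∣p^[1+j] = ℤ∣.divides (pℤ^ j) (≡.trans (pℤ^-suc j) (ℤP.*-comm (+ p) _))
      p∣termA : p ∣ ∣ A ∣ * (x * x * 1)
      p∣termA = ≡.subst (p ∣_) (ℤP.abs-* A (+ (x * x * 1))) (ℤ∣.∣⇒∣ᵤ
        (ℤ∣.∣m+n∣n⇒∣m {m = term A x 0} (ℤ∣.∣-trans p∣p^[1+j] h) p∣termB))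
      p∣x : p ∣ x
      p∣x with euclidsLemma ∣ A ∣ (x * x * 1) p-prime p∣termA
      ... | inj₁ p∣A  = ⊥-elim (p∤A p∣A)
      ... | inj₂ p∣x² = ∣-square⇒∣ x (≡.subst (p ∣_) (ℕP.*-identityʳ (x * x)) p∣x²)
    ... | divides q ≡.refl =
      let (hA , hB) = ∣-sum⇒∣-terms j 1 t A B q y p∤A p∤B odd (∣-cancel-p j _
                        (≡.subst (pℤ^ (suc j) ∣ℤ_)
                          (≡.trans (≡.cong₂ ℤ._+_ (term-p* A q) (term-suc B y t))
                                   (≡.sym (ℤP.*-distribˡ-+ (+ p) _ _))) h))
      in ≡.subst (pℤ^ (suc j) ∣ℤ_) (≡.sym (term-p* A q)) (∣-mul-p j _ hA) ,
         ≡.subst (pℤ^ (suc j) ∣ℤ_) (≡.sym (term-suc B y t)) (∣-mul-p j _ hB)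

  ∣-term⇒^⌈/2⌉∣ : ∀ r s A x → ¬ (p ∣ ∣ A ∣) → pℤ^ (r + s) ∣ℤ term A x s → p ^ ⌈ r /2⌉ ∣ x
  ∣-term⇒^⌈/2⌉∣ r s A x p∤A h = ^∣-square⇒^⌈/2⌉∣ r x (ℕ∣.*-cancelʳ-∣ (p ^ s) {{ℕP.m^n≢0 p s}}
    (≡.subst (_∣ x * x * p ^ s) (ℕP.^-distribˡ-+-* p r s)
      (^∣-cancel-coprime (r + s) ∣ A ∣ (x * x * p ^ s) p∤A
        (≡.subst (p ^ (r + s) ∣_) (ℤP.abs-* A (+ (x * x * p ^ s))) (ℤ∣.∣⇒∣ᵤ h)))))

  ^⌈/2⌉∣⇒∣-term : ∀ r s A x → p ^ ⌈ r /2⌉ ∣ x → pℤ^ (r + s) ∣ℤ term A x s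
  ^⌈/2⌉∣⇒∣-term r s A x h = ℤ∣.∣ᵤ⇒∣
    (≡.subst (p ^ (r + s) ∣_) (≡.sym (ℤP.abs-* A (+ (x * x * p ^ s))))
      (ℕ∣.∣n⇒∣m*n ∣ A ∣ (≡.subst (_∣ x * x * p ^ s) (≡.sym (ℕP.^-distribˡ-+-* p r s))
        (ℕ∣.*-monoˡ-∣ (p ^ s) (^⌈/2⌉∣⇒^∣-square r x h)))))

  ∣-sum⇒^⌈/2⌉∣ : ∀ {j} s t r₁ r₂ A B x y → ¬ (p ∣ ∣ A ∣) → ¬ (p ∣ ∣ B ∣) → Odd (s + t) →
                 j ≡ r₁ + s → j ≡ r₂ + t → pℤ^ j ∣ℤ term A x s ℤ.+ term B y t →
                 (p ^ ⌈ r₁ /2⌉ ∣ x) × (p ^ ⌈ r₂ /2⌉ ∣ y)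
  ∣-sum⇒^⌈/2⌉∣ s t r₁ r₂ A B x y p∤A p∤B odd ≡.refl j≡r₂+t h
    with ∣-sum⇒∣-terms (r₁ + s) s t A B x y p∤A p∤B odd h
  ... | hA , hB = ∣-term⇒^⌈/2⌉∣ r₁ s A x p∤A hA ,
                  ∣-term⇒^⌈/2⌉∣ r₂ t B y p∤B (≡.subst (λ k → pℤ^ k ∣ℤ term B y t) j≡r₂+t hB)

  ^⌈/2⌉∣⇒∣-sum : ∀ {j} s t r₁ r₂ A B x y → j ≡ r₁ + s → j ≡ r₂ + t →
                 p ^ ⌈ r₁ /2⌉ ∣ x → p ^ ⌈ r₂ /2⌉ ∣ y → pℤ^ j ∣ℤ term A x s ℤ.+ term B y t
  ^⌈/2⌉∣⇒∣-sum s t r₁ r₂ A B x y ≡.refl j≡r₂+t hx hy = ℤ∣.∣m∣n⇒∣m+n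
    (^⌈/2⌉∣⇒∣-term r₁ s A x hx)
    (≡.subst (λ k → pℤ^ k ∣ℤ term B y t) (≡.sym j≡r₂+t) (^⌈/2⌉∣⇒∣-term r₂ t B y hy))

  ∣-scaled⇒∣ : ∀ k₁ k₂ u d → ¬ (p ∣ ∣ u ∣) →
               + (p ^ k₁ * p ^ k₂) ∣ℤ u ℤ.* d ℤ.* + (p ^ k₂) → p ^ k₁ ∣ ∣ d ∣
  ∣-scaled⇒∣ k₁ k₂ u d p∤u h = ^∣-cancel-coprime k₁ ∣ u ∣ ∣ d ∣ p∤u
    (ℕ∣.*-cancelʳ-∣ (p ^ k₂) {{ℕP.m^n≢0 p k₂}}
      (≡.subst (p ^ k₁ * p ^ k₂ ∣_) abs-udp (ℤ∣.∣⇒∣ᵤ h)))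
    where
    abs-udp : ∣ u ℤ.* d ℤ.* + (p ^ k₂) ∣ ≡ ∣ u ∣ * ∣ d ∣ * p ^ k₂
    abs-udp = ≡.trans (ℤP.abs-* (u ℤ.* d) (+ (p ^ k₂))) (≡.cong (_* p ^ k₂) (ℤP.abs-* u d))

  odd-prime∤2* : p ℕ.% 2 ≡ 1 → ∀ a → ¬ (p ∣ ∣ a ∣) → ¬ (p ∣ ∣ + 2 ℤ.* a ∣)
  odd-prime∤2* p-odd a p∤a p∣2a
    with euclidsLemma 2 ∣ a ∣ p-prime (≡.subst (p ∣_) (ℤP.abs-* (+ 2) a) p∣2a)
  ... | inj₂ p∣a = p∤a p∣a
  ... | inj₁ p∣2 with ℕP.≤-antisym (ℕ∣.∣⇒≤ p∣2) (ℕ.nonTrivial⇒n>1 p {{prime⇒nonTrivial p-prime}})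
  ...   | ≡.refl with p-odd
  ...     | ()

  ^⌈/2⌉∣-product : ∀ k₁ k₂ u x x′ → p ^ ⌈ suc k₁ /2⌉ ∣ x → p ^ ⌈ k₁ /2⌉ ∣ x′ →
                   + (p ^ suc k₁ * p ^ k₂) ∣ℤ u ℤ.* + x ℤ.* + x′ ℤ.* + (p ^ k₂)
  ^⌈/2⌉∣-product k₁ k₂ u x x′ hx hx′ = ℤ∣.∣ᵤ⇒∣
    (≡.subst (p ^ suc k₁ * p ^ k₂ ∣_) (≡.sym abs-uxx′p)
      (ℕ∣.∣n⇒∣m*n ∣ u ∣ (ℕ∣.*-monoˡ-∣ (p ^ k₂)
      (≡.subst (_∣ x * x′) p^⌈/2⌉*p^⌈/2⌉ (ℕ∣.*-pres-∣ hx hx′)))))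
    where
    p^⌈/2⌉*p^⌈/2⌉ : p ^ ⌈ suc k₁ /2⌉ * p ^ ⌈ k₁ /2⌉ ≡ p ^ suc k₁
    p^⌈/2⌉*p^⌈/2⌉ = ≡.trans (≡.sym (ℕP.^-distribˡ-+-* p ⌈ suc k₁ /2⌉ ⌈ k₁ /2⌉))
                            (≡.cong (p ^_) (⌈suc/2⌉+⌈/2⌉≡suc k₁))
    reassoc : ∀ a b d e → a * b * d * e ≡ a * (b * d * e)
    reassoc = ℕSolver.solve-∀
    abs-uxx′p : ∣ u ℤ.* + x ℤ.* + x′ ℤ.* + (p ^ k₂) ∣ ≡ ∣ u ∣ * (x * x′ * p ^ k₂)
    abs-uxx′p = ≡.trans (ℤP.abs-* (u ℤ.* + x ℤ.* + x′) (+ (p ^ k₂)))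
      (≡.trans (≡.cong (_* p ^ k₂) (≡.trans (ℤP.abs-* (u ℤ.* + x) (+ x′))
                                            (≡.cong (_* x′) (ℤP.abs-* u (+ x)))))
               (reassoc ∣ u ∣ x x′ (p ^ k₂)))

  -- If y n ≡ -1 (mod p) then (y y n) n ≡ (y n)² ≡ 1 (mod p).
  inverse-mod-p : ∀ n → ¬ (p ∣ n) → Σ ℕ (λ m → + p ∣ℤ + m ℤ.* + n ℤ.- + 1)
  inverse-mod-p n p∤n with coprime-Bézout coprime
    where
    coprime : Coprime p n
    coprime (d∣p , d∣n) with prime⇒irreducible p-prime d∣p
    ... | inj₁ d≡1    = d≡1
    ... | inj₂ ≡.refl = ⊥-elim (p∤n d∣n)
  ... | Bézout.-+ x y 1+xp≡yn =
    y , ℤ∣.divides (+ x) (yn-1≡xp (+ y) (+ x) (+ n) (+ p) (pos-+-*-≡ 1 x p y n 1+xp≡yn))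
    where
    yn-1≡xp : ∀ Y X N P → + 1 ℤ.+ X ℤ.* P ≡ Y ℤ.* N → Y ℤ.* N ℤ.- + 1 ≡ X ℤ.* P
    yn-1≡xp Y X N P e = ≡.trans (≡.cong (ℤ._- + 1) (≡.sym e)) (1+z-1≡z (X ℤ.* P))
      where
      1+z-1≡z : ∀ Z → + 1 ℤ.+ Z ℤ.- + 1 ≡ Z
      1+z-1≡z = ℤSolver.solve-∀
  ... | Bézout.+- x y 1+yn≡xp = y * y * n , ℤ∣.divides ((+ y ℤ.* + n ℤ.- + 1) ℤ.* + x)
      (≡.trans (≡.cong (λ t → t ℤ.* + n ℤ.- + 1) (≡.trans (ℤP.pos-* (y * y) n)
                                                          (≡.cong (ℤ._* + n) (ℤP.pos-* y y))))
               (yyn*n-1≡[yn-1]xp (+ y) (+ x) (+ n) (+ p) (pos-+-*-≡ 1 y n x p 1+yn≡xp)))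
    where
    yyn*n-1≡[yn-1]xp : ∀ Y X N P → + 1 ℤ.+ Y ℤ.* N ≡ X ℤ.* P →
                       Y ℤ.* Y ℤ.* N ℤ.* N ℤ.- + 1 ≡ (Y ℤ.* N ℤ.- + 1) ℤ.* X ℤ.* P
    yyn*n-1≡[yn-1]xp Y X N P e = ≡.trans (factor Y N) (≡.trans (≡.cong ((Y ℤ.* N ℤ.- + 1) ℤ.*_) e)
                                                    (≡.sym (ℤP.*-assoc (Y ℤ.* N ℤ.- + 1) X P)))
      where
      factor : ∀ Y N → Y ℤ.* Y ℤ.* N ℤ.* N ℤ.- + 1 ≡ (Y ℤ.* N ℤ.- + 1) ℤ.* (+ 1 ℤ.+ Y ℤ.* N)
      factor = ℤSolver.solve-∀

  -- Parity is used here: ⌈k₁/2⌉ + ⌈k₂/2⌉ = ⌈j₁/2⌉ + ⌈j₂/2⌉ + 1 only when k₁ + k₂ is odd.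
  isotropic-count-balance : ∀ j₁ j₂ → Odd (suc j₁ + suc j₂) →
    p ^ suc j₁ * p ^ suc j₂ * (p ^ ⌈ j₁ /2⌉ * p ^ ⌈ j₂ /2⌉) ≡
    p ^ (j₁ + suc j₂) * (p ^ ⌈ suc j₁ /2⌉ * p ^ ⌈ suc j₂ /2⌉)
  isotropic-count-balance j₁ j₂ k-odd = begin
    p ^ suc j₁ * p ^ suc j₂ * (p ^ ⌈ j₁ /2⌉ * p ^ ⌈ j₂ /2⌉)
      ≡⟨ ≡.cong (_* (p ^ ⌈ j₁ /2⌉ * p ^ ⌈ j₂ /2⌉)) (ℕP.^-distribˡ-+-* p (suc j₁) (suc j₂)) ⟨
    p ^ (suc j₁ + suc j₂) * (p ^ ⌈ j₁ /2⌉ * p ^ ⌈ j₂ /2⌉)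
      ≡⟨ ^-+-+ (suc j₁ + suc j₂) ⌈ j₁ /2⌉ ⌈ j₂ /2⌉ ⟩
    p ^ ((suc j₁ + suc j₂) + (⌈ j₁ /2⌉ + ⌈ j₂ /2⌉))
      ≡⟨ ≡.cong (p ^_) exponents ⟩
    p ^ ((j₁ + suc j₂) + (⌈ suc j₁ /2⌉ + ⌈ suc j₂ /2⌉))
      ≡⟨ ^-+-+ (j₁ + suc j₂) ⌈ suc j₁ /2⌉ ⌈ suc j₂ /2⌉ ⟨
    p ^ (j₁ + suc j₂) * (p ^ ⌈ suc j₁ /2⌉ * p ^ ⌈ suc j₂ /2⌉) ∎
    where
    open ≡.≡-Reasoning
    ^-+-+ : ∀ a b d → p ^ a * (p ^ b * p ^ d) ≡ p ^ (a + (b + d))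
    ^-+-+ a b d = ≡.sym (≡.trans (ℕP.^-distribˡ-+-* p a (b + d)) (≡.cong (p ^ a *_) (ℕP.^-distribˡ-+-* p b d)))
    j-odd : Odd (j₁ + j₂)
    j-odd with ≡.subst Odd (≡.cong suc (ℕP.+-suc j₁ j₂)) k-odd
    ... | odd-+2 odd = odd
    exponents : (suc j₁ + suc j₂) + (⌈ j₁ /2⌉ + ⌈ j₂ /2⌉) ≡
                (j₁ + suc j₂) + (⌈ suc j₁ /2⌉ + ⌈ suc j₂ /2⌉)
    exponents = ≡.sym (≡.trans (≡.cong (λ t → (j₁ + suc j₂) + t) (⌈suc/2⌉-sum-Odd j₁ j₂ j-odd))
                               (ℕP.+-suc (j₁ + suc j₂) (⌈ j₁ /2⌉ + ⌈ j₂ /2⌉)))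

module GeneratorWords where
  open import Data.List using (List; []; _∷_; _++_; replicate)

  upperLeft lowerLeft : List Gen → ℤ
  upperLeft w = M2.a (wordMat w)
  lowerLeft w = M2.c (wordMat w)

  Tᵐ : ℕ → List Gen
  Tᵐ m = replicate m genT

  STᵐS : ℕ → List Gen
  STᵐS m = genS ∷ Tᵐ m ++ genS ∷ []

  STᵐSTⁿS : ℕ → ℕ → List Gen
  STᵐSTⁿS m n = genS ∷ Tᵐ m ++ genS ∷ Tᵐ n ++ genS ∷ []

  lowerLeft-T∷ : ∀ w → lowerLeft (genT ∷ w) ≡ lowerLeft w
  lowerLeft-T∷ w = normalise (upperLeft w) (lowerLeft w)
    where
    normalise : ∀ a c → + 0 ℤ.* a ℤ.+ + 1 ℤ.* c ≡ c
    normalise = ℤSolver.solve-∀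

  upperLeft-T∷ : ∀ w → upperLeft (genT ∷ w) ≡ upperLeft w ℤ.+ lowerLeft w
  upperLeft-T∷ w = normalise (upperLeft w) (lowerLeft w)
    where
    normalise : ∀ a c → + 1 ℤ.* a ℤ.+ + 1 ℤ.* c ≡ a ℤ.+ c
    normalise = ℤSolver.solve-∀

  lowerLeft-S∷ : ∀ w → lowerLeft (genS ∷ w) ≡ upperLeft w
  lowerLeft-S∷ w = normalise (upperLeft w) (lowerLeft w)
    where
    normalise : ∀ a c → + 1 ℤ.* a ℤ.+ + 0 ℤ.* c ≡ a
    normalise = ℤSolver.solve-∀

  upperLeft-S∷ : ∀ w → upperLeft (genS ∷ w) ≡ ℤ.- lowerLeft w
  upperLeft-S∷ w = normalise (upperLeft w) (lowerLeft w)
    where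
    normalise : ∀ a c → + 0 ℤ.* a ℤ.+ ℤ.- (+ 1) ℤ.* c ≡ ℤ.- c
    normalise = ℤSolver.solve-∀

  lowerLeft-Tᵐ++ : ∀ m w → lowerLeft (Tᵐ m ++ w) ≡ lowerLeft w
  lowerLeft-Tᵐ++ zero    w = ≡.refl
  lowerLeft-Tᵐ++ (suc m) w = ≡.trans (lowerLeft-T∷ (Tᵐ m ++ w)) (lowerLeft-Tᵐ++ m w)

  upperLeft-Tᵐ++ : ∀ m w → upperLeft (Tᵐ m ++ w) ≡ upperLeft w ℤ.+ + m ℤ.* lowerLeft w
  upperLeft-Tᵐ++ zero    w = ≡.sym (≡.trans (≡.cong (λ t → upperLeft w ℤ.+ t) (ℤP.*-zeroˡ (lowerLeft w)))
                                           (ℤP.+-identityʳ (upperLeft w)))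
  upperLeft-Tᵐ++ (suc m) w = ≡.trans (upperLeft-T∷ (Tᵐ m ++ w))
    (≡.trans (≡.cong₂ ℤ._+_ (upperLeft-Tᵐ++ m w) (lowerLeft-Tᵐ++ m w))
             (normalise (upperLeft w) (+ m) (lowerLeft w)))
    where
    normalise : ∀ a m c → a ℤ.+ m ℤ.* c ℤ.+ c ≡ a ℤ.+ (+ 1 ℤ.+ m) ℤ.* c
    normalise = ℤSolver.solve-∀

  lowerLeft-STᵐS : ∀ m → lowerLeft (STᵐS m) ≡ + m
  lowerLeft-STᵐS m = ≡.trans (lowerLeft-S∷ (Tᵐ m ++ genS ∷ []))
    (≡.trans (upperLeft-Tᵐ++ m (genS ∷ [])) (normalise (+ m)))
    where
    normalise : ∀ m → + 0 ℤ.+ m ℤ.* + 1 ≡ m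
    normalise = ℤSolver.solve-∀

  lowerLeft-STᵐSTⁿS : ∀ m n → lowerLeft (STᵐSTⁿS m n) ≡ + m ℤ.* + n ℤ.- + 1
  lowerLeft-STᵐSTⁿS m n = begin
    lowerLeft (STᵐSTⁿS m n)                     ≡⟨ lowerLeft-S∷ (Tᵐ m ++ STⁿS) ⟩
    upperLeft (Tᵐ m ++ STⁿS)                    ≡⟨ upperLeft-Tᵐ++ m STⁿS ⟩
    upperLeft STⁿS ℤ.+ + m ℤ.* lowerLeft STⁿS   ≡⟨ ≡.cong₂ (λ a c → a ℤ.+ + m ℤ.* c)
                                                     (upperLeft-S∷ (Tᵐ n ++ genS ∷ []))
                                                     (lowerLeft-S∷ (Tᵐ n ++ genS ∷ [])) ⟩
    ℤ.- lowerLeft (Tᵐ n ++ genS ∷ []) ℤ.+ + m ℤ.* upperLeft (Tᵐ n ++ genS ∷ [])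
      ≡⟨ ≡.cong₂ (λ c a → ℤ.- c ℤ.+ + m ℤ.* a) (lowerLeft-Tᵐ++ n (genS ∷ []))
                                               (upperLeft-Tᵐ++ n (genS ∷ [])) ⟩
    ℤ.- (+ 1) ℤ.+ + m ℤ.* (+ 0 ℤ.+ + n ℤ.* + 1)  ≡⟨ normalise (+ m) (+ n) ⟩
    + m ℤ.* + n ℤ.- + 1                          ∎
    where
    open ≡.≡-Reasoning
    STⁿS = genS ∷ Tᵐ n ++ genS ∷ []
    normalise : ∀ m n → ℤ.- (+ 1) ℤ.+ m ℤ.* (+ 0 ℤ.+ n ℤ.* + 1) ≡ m ℤ.* n ℤ.- + 1
    normalise = ℤSolver.solve-∀

∣∧<⇒≡0 : ∀ {m n} → m ℕ∣.∣ n → n ℕ.< m → n ≡ 0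
∣∧<⇒≡0 {n = zero}  _   _   = ≡.refl
∣∧<⇒≡0 {n = suc _} m∣n n<m = ⊥-elim (ℕP.<⇒≱ n<m (ℕ∣.∣⇒≤ m∣n))

Fin-∣-diff⇒≡ : ∀ {n} (b g : Fin n) → n ℕ∣.∣ ∣ + toℕ b ℤ.- + toℕ g ∣ → b ≡ g
Fin-∣-diff⇒≡ {n} b g n∣b-g =
  FinP.toℕ-injective (ℤP.+-injective (ℤP.i-j≡0⇒i≡j _ _ (ℤP.∣i∣≡0⇒i≡0 ∣b-g∣≡0)))
  where
  ∣b-g∣≡∣b⊖g∣ : ∣ + toℕ b ℤ.- + toℕ g ∣ ≡ ∣ toℕ b ⊖ toℕ g ∣
  ∣b-g∣≡∣b⊖g∣ = ≡.cong ∣_∣ (ℤP.m-n≡m⊖n (toℕ b) (toℕ g))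
  ∣b-g∣<n : ∣ + toℕ b ℤ.- + toℕ g ∣ ℕ.< n
  ∣b-g∣<n = ≡.subst (ℕ._< n) (≡.sym ∣b-g∣≡∣b⊖g∣)
    (ℕP.≤-<-trans (ℤP.∣m⊝n∣≤m⊔n (toℕ b) (toℕ g)) (ℕP.⊔-lub (FinP.toℕ<n b) (FinP.toℕ<n g)))
  ∣b-g∣≡0 : ∣ + toℕ b ℤ.- + toℕ g ∣ ≡ 0
  ∣b-g∣≡0 = ∣∧<⇒≡0 n∣b-g ∣b-g∣<n

module FourierAnalysis {c ℓ : Level} (F : CharZeroField c ℓ) (ζ : CharZeroField.Carrier F)
                       (n₁ n₂ : ℕ) .{{_ : ℕ.NonZero n₁}} .{{_ : ℕ.NonZero n₂}} (a₁ a₂ : ℤ)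
                       (ζ-primitive : FieldOps.IsPrimitiveRoot F ζ (n₁ ℕ.* n₂)) where
  open CharZeroField F
  open FieldOps F
  open FieldProperties F
  open Weil F ζ n₁ n₂ a₁ a₂

  instance
    N≢0 : ℕ.NonZero N
    N≢0 = ℕP.m*n≢0 n₁ n₂

  open RootOfUnity F ζ N ζ-primitive
  open import Data.Integer.Divisibility.Signed as ℤ∣ using (_∣_; _∣?_; divides)
  open import Relation.Binary.Reasoning.Setoid setoid

  eN≡e : ∀ z → eN z ≡ e z
  eN≡e (+ _)    = ≡.refl
  eN≡e -[1+ _ ] = ≡.refl

  eN-+ : ∀ x y → eN (x ℤ.+ y) ≈ eN x * eN y
  eN-+ x y = begin
    eN (x ℤ.+ y)    ≡⟨ eN≡e (x ℤ.+ y) ⟩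
    e (x ℤ.+ y)     ≈⟨ e-+ x y ⟩
    e x * e y       ≡⟨ ≡.cong₂ _*_ (eN≡e x) (eN≡e y) ⟨
    eN x * eN y     ∎

  ∣⇒eN≈1 : ∀ {z} → + N ∣ z → eN z ≈ 1#
  ∣⇒eN≈1 {z} N∣z = trans (reflexive (eN≡e z)) (∣⇒e≈1 N∣z)

  eN≈1⇒∣ : ∀ {z} → eN z ≈ 1# → + N ∣ z
  eN≈1⇒∣ {z} eᶻ≈1 = e≈1⇒∣ (trans (reflexive (≡.sym (eN≡e z))) eᶻ≈1)

  eN-*ℕ : ∀ k z → eN (+ k ℤ.* z) ≈ pow (eN z) k
  eN-*ℕ k z = begin
    eN (+ k ℤ.* z)   ≡⟨ eN≡e (+ k ℤ.* z) ⟩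
    e (+ k ℤ.* z)    ≈⟨ e-*ℕ k z ⟩
    pow (e z) k      ≡⟨ ≡.cong (λ t → pow t k) (eN≡e z) ⟨
    pow (eN z) k     ∎

  eN-sum-zero : ∀ n z → ¬ (+ N ∣ z) → + N ∣ + n ℤ.* z → sumRange n (λ i → eN (+ i ℤ.* z)) ≈ 0#
  eN-sum-zero n z N∤z N∣nz =
    trans (sumRange-cong n (λ i _ → reflexive (eN≡e (+ i ℤ.* z)))) (character-sum-zero n z N∤z N∣nz)

  χ χ⁻ : ∀ {n} → ℤ → ℕ → Fin n → Fin n → Carrier
  χ  a m γ β = eN (+ 2 ℤ.* a ℤ.* Z γ ℤ.* Z β ℤ.* + m)
  χ⁻ a m γ β = eN (ℤ.- (+ 2 ℤ.* a ℤ.* Z γ ℤ.* Z β ℤ.* + m))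

  module Orthogonality (n m : ℕ) (a : ℤ) (n*m≡N : n ℕ.* m ≡ N)
                       (nondegenerate : ∀ d → + N ∣ + 2 ℤ.* a ℤ.* d ℤ.* + m → n ℕ∣.∣ ∣ d ∣) where
    kernel : Fin n → Fin n → Carrier
    kernel γ β = sumFin (λ δ → χ a m δ β * χ⁻ a m γ δ)

    phase : Fin n → Fin n → ℤ
    phase γ β = + 2 ℤ.* a ℤ.* (Z β ℤ.- Z γ) ℤ.* + m

    kernel-term : ∀ γ β δ → χ a m δ β * χ⁻ a m γ δ ≈ eN (Z δ ℤ.* phase γ β)
    kernel-term γ β δ =
      trans (sym (eN-+ (+ 2 ℤ.* a ℤ.* Z δ ℤ.* Z β ℤ.* + m) (ℤ.- (+ 2 ℤ.* a ℤ.* Z γ ℤ.* Z δ ℤ.* + m))))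
      (reflexive (≡.cong eN (factor-δ (+ 2 ℤ.* a) (Z δ) (Z β) (Z γ) (+ m))))
      where
      factor-δ : ∀ a d b g m →
                 a ℤ.* d ℤ.* b ℤ.* m ℤ.+ ℤ.- (a ℤ.* g ℤ.* d ℤ.* m) ≡ d ℤ.* (a ℤ.* (b ℤ.- g) ℤ.* m)
      factor-δ = ℤSolver.solve-∀

    N∣n*phase : ∀ γ β → + N ∣ + n ℤ.* phase γ β
    N∣n*phase γ β = divides (+ 2 ℤ.* a ℤ.* (Z β ℤ.- Z γ))
      (≡.trans (x∙yz≡y∙xz (+ n) (+ 2 ℤ.* a ℤ.* (Z β ℤ.- Z γ)) (+ m))
               (≡.cong (λ t → + 2 ℤ.* a ℤ.* (Z β ℤ.- Z γ) ℤ.* t)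
                       (≡.trans (≡.sym (ℤP.pos-* n m)) (≡.cong +_ n*m≡N))))
      where
      x∙yz≡y∙xz : ∀ n q m → n ℤ.* (q ℤ.* m) ≡ q ℤ.* (n ℤ.* m)
      x∙yz≡y∙xz = ℤSolver.solve-∀

    kernel-≢ : ∀ γ β → γ ≢ β → kernel γ β ≈ 0#
    kernel-≢ γ β γ≢β = trans (sumFin-cong (kernel-term γ β))
      (eN-sum-zero n (phase γ β) (λ N∣phase → γ≢β (≡.sym (Fin-∣-diff⇒≡ β γ (nondegenerate _ N∣phase))))
                   (N∣n*phase γ β))

    kernel-≡ : ∀ β → kernel β β ≈ ofℕ commRing n
    kernel-≡ β = begin
      kernel β β
        ≈⟨ sumFin-cong (λ δ → trans (kernel-term β β δ) (reflexive (≡.cong eN (phase≡0 δ)))) ⟩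
      sumFin {n} (λ _ → 1#)       ≈⟨ sumFin-const n 1# ⟩
      ofℕ commRing n * 1#         ≈⟨ *-identityʳ _ ⟩
      ofℕ commRing n              ∎
      where
      phase≡0 : ∀ δ → Z δ ℤ.* phase β β ≡ + 0
      phase≡0 δ = vanish (+ 2 ℤ.* a) (Z δ) (Z β) (+ m)
        where
        vanish : ∀ a d b m → d ℤ.* (a ℤ.* (b ℤ.- b) ℤ.* m) ≡ + 0
        vanish = ℤSolver.solve-∀

  eN-sum-units : ∀ M p d z → p ≡ suc d → N ≡ M ℕ.* p → + N ∣ + p ℤ.* z →
    sumRange M (λ i → sumRange d (λ r → eN (+ (i ℕ.* p ℕ.+ suc r) ℤ.* z))) ≈
    ofℕ commRing N * indicator (+ N ∣? z) - ofℕ commRing M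
  eN-sum-units M p d z p≡1+d N≡Mp N∣pz =
    trans (sumRange-cong M (λ i _ → sumRange-cong d (λ r _ → reflexive (eN≡e (+ (i ℕ.* p ℕ.+ suc r) ℤ.* z)))))
          (character-sum-units M p d z p≡1+d N≡Mp N∣pz)

  𝓕 𝓕⁻ : Vec → Vec
  𝓕  w β₁ β₂ = sum² (λ γ₁ γ₂ → (eB₁ γ₁ β₁ * eB₂ γ₂ β₂) * w γ₁ γ₂)
  𝓕⁻ w β₁ β₂ = sum² (λ δ₁ δ₂ → (χ a₁ n₂ δ₁ β₁ * χ a₂ n₁ δ₂ β₂) * w δ₁ δ₂)

  𝓕-cong : ∀ {w w′} → (∀ x y → w x y ≈ w′ x y) → ∀ β₁ β₂ → 𝓕 w β₁ β₂ ≈ 𝓕 w′ β₁ β₂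
  𝓕-cong w≈w′ β₁ β₂ = sum²-cong {n₁} {n₂} (λ x y → *-congˡ (w≈w′ x y))

  𝓕-*ˡ : ∀ k w β₁ β₂ → 𝓕 (λ x y → k * w x y) β₁ β₂ ≈ k * 𝓕 w β₁ β₂
  𝓕-*ˡ k w β₁ β₂ =
    trans (sum²-cong {n₁} {n₂} (λ x y → x∙yz≈y∙xz _ k _)) (sym (*-distribˡ-sum² {n₁} {n₂} k _))

  𝓕-minus : ∀ w w′ β₁ β₂ → 𝓕 (λ x y → w x y - w′ x y) β₁ β₂ ≈ 𝓕 w β₁ β₂ - 𝓕 w′ β₁ β₂
  𝓕-minus w w′ β₁ β₂ = trans (sum²-cong {n₁} {n₂} (λ x y → x[y-z]≈xy-xz _ _ _))
    (sum²-minus (λ x y → (eB₁ x β₁ * eB₂ y β₂) * w x y) (λ x y → (eB₁ x β₁ * eB₂ y β₂) * w′ x y))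
    where open import Algebra.Properties.Ring ring using (x[y-z]≈xy-xz)

  𝓕-zero : ∀ {w} → (∀ x y → w x y ≈ 0#) → ∀ β₁ β₂ → 𝓕 w β₁ β₂ ≈ 0#
  𝓕-zero w≈0 β₁ β₂ = sum²-zero {n₁} {n₂} (λ x y → trans (*-congˡ (w≈0 x y)) (zeroʳ _))

  𝓕⁻-zero : ∀ {w} → (∀ x y → w x y ≈ 0#) → ∀ β₁ β₂ → 𝓕⁻ w β₁ β₂ ≈ 0#
  𝓕⁻-zero w≈0 β₁ β₂ = sum²-zero {n₁} {n₂} (λ x y → trans (*-congˡ (w≈0 x y)) (zeroʳ _))

  origin₁ : Fin n₁
  origin₁ = Fin.fromℕ< (ℕ.>-nonZero⁻¹ n₁)

  origin₂ : Fin n₂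
  origin₂ = Fin.fromℕ< (ℕ.>-nonZero⁻¹ n₂)

  Z-origin₁ : Z origin₁ ≡ + 0
  Z-origin₁ = ≡.cong +_ (FinP.toℕ-fromℕ< (ℕ.>-nonZero⁻¹ n₁))

  Z-origin₂ : Z origin₂ ≡ + 0
  Z-origin₂ = ≡.cong +_ (FinP.toℕ-fromℕ< (ℕ.>-nonZero⁻¹ n₂))

  χ-origin : ∀ {n} a m (δ o : Fin n) → Z o ≡ + 0 → χ a m δ o ≈ 1#
  χ-origin a m δ o Zo≡0 = ∣⇒eN≈1 (divides (+ 0)
    (≡.trans (≡.cong (λ t → + 2 ℤ.* a ℤ.* Z δ ℤ.* t ℤ.* + m) Zo≡0) (vanish (+ 2 ℤ.* a) (Z δ) (+ m))))
    where
    vanish : ∀ u d m → u ℤ.* d ℤ.* + 0 ℤ.* m ≡ + 0 ℤ.* + N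
    vanish = ℤSolver.solve-∀

  χ⁻-origin : ∀ {n} a m (δ o : Fin n) → Z o ≡ + 0 → χ⁻ a m δ o ≈ 1#
  χ⁻-origin a m δ o Zo≡0 = ∣⇒eN≈1 (divides (+ 0)
    (≡.trans (≡.cong (λ t → ℤ.- (+ 2 ℤ.* a ℤ.* Z δ ℤ.* t ℤ.* + m)) Zo≡0) (vanish (+ 2 ℤ.* a) (Z δ) (+ m))))
    where
    vanish : ∀ u d m → ℤ.- (u ℤ.* d ℤ.* + 0 ℤ.* m) ≡ + 0 ℤ.* + N
    vanish = ℤSolver.solve-∀

  𝓕-at-origin : ∀ w → 𝓕 w origin₁ origin₂ ≈ sum² w
  𝓕-at-origin w = sum²-cong {n₁} {n₂} (λ γ₁ γ₂ → trans (*-congʳ (trans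
    (*-cong (χ⁻-origin a₁ n₂ γ₁ origin₁ Z-origin₁) (χ⁻-origin a₂ n₁ γ₂ origin₂ Z-origin₂))
    (*-identityˡ 1#))) (*-identityˡ _))

  module Inversion
    (nondegenerate₁ : ∀ d → + N ∣ + 2 ℤ.* a₁ ℤ.* d ℤ.* + n₂ → n₁ ℕ∣.∣ ∣ d ∣)
    (nondegenerate₂ : ∀ d → + N ∣ + 2 ℤ.* a₂ ℤ.* d ℤ.* + n₁ → n₂ ℕ∣.∣ ∣ d ∣) where
    open Orthogonality n₁ n₂ a₁ ≡.refl nondegenerate₁
      renaming (kernel to kernel₁; kernel-≢ to kernel₁-≢; kernel-≡ to kernel₁-≡)
    open Orthogonality n₂ n₁ a₂ (ℕP.*-comm n₂ n₁) nondegenerate₂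
      renaming (kernel to kernel₂; kernel-≢ to kernel₂-≢; kernel-≡ to kernel₂-≡)

    sum²-kernel : ∀ (w : Vec) β₁ β₂ →
      sum² (λ γ₁ γ₂ → w γ₁ γ₂ * (kernel₁ γ₁ β₁ * kernel₂ γ₂ β₂)) ≈
      w β₁ β₂ * (ofℕ commRing n₁ * ofℕ commRing n₂)
    sum²-kernel w β₁ β₂ = begin
      sum² f
        ≈⟨ sumFin-delta {f = λ γ₁ → sumFin (f γ₁)} β₁ (λ γ₁ γ₁≢β₁ → sumFin-zero {n₂} (λ γ₂ →
             trans (*-congˡ (trans (*-congʳ (kernel₁-≢ γ₁ β₁ γ₁≢β₁)) (zeroˡ _))) (zeroʳ _))) ⟩
      sumFin (f β₁)
        ≈⟨ sumFin-delta {f = f β₁} β₂ (λ γ₂ γ₂≢β₂ →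
             trans (*-congˡ (trans (*-congˡ (kernel₂-≢ γ₂ β₂ γ₂≢β₂)) (zeroʳ _))) (zeroʳ _)) ⟩
      f β₁ β₂
        ≈⟨ *-congˡ (*-cong (kernel₁-≡ β₁) (kernel₂-≡ β₂)) ⟩
      w β₁ β₂ * (ofℕ commRing n₁ * ofℕ commRing n₂) ∎
      where
      f : Fin n₁ → Fin n₂ → Carrier
      f γ₁ γ₂ = w γ₁ γ₂ * (kernel₁ γ₁ β₁ * kernel₂ γ₂ β₂)

    𝓕⁻∘𝓕 : ∀ w β₁ β₂ → 𝓕⁻ (𝓕 w) β₁ β₂ ≈ ofℕ commRing N * w β₁ β₂
    𝓕⁻∘𝓕 w β₁ β₂ = begin
      𝓕⁻ (𝓕 w) β₁ β₂
        ≈⟨ sum²-cong {n₁} {n₂} (λ δ₁ δ₂ → *-distribˡ-sum² {n₁} {n₂} _ _) ⟩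
      sum² (λ δ₁ δ₂ → sum² (summand δ₁ δ₂))
        ≈⟨ sum²-comm summand ⟩
      sum² (λ γ₁ γ₂ → sum² (λ δ₁ δ₂ → summand δ₁ δ₂ γ₁ γ₂))
        ≈⟨ sum²-cong {n₁} {n₂} (λ γ₁ γ₂ → trans (sum²-cong {n₁} {n₂} (λ δ₁ δ₂ → regroup _ _ _ _ _))
                                               (sym (*-distribˡ-sum² {n₁} {n₂} (w γ₁ γ₂) _))) ⟩
      sum² (λ γ₁ γ₂ → w γ₁ γ₂ * sum² (λ δ₁ δ₂ → κ₁ γ₁ δ₁ * κ₂ γ₂ δ₂))
        ≈⟨ sum²-cong {n₁} {n₂} (λ γ₁ γ₂ → *-congˡ (sum²-product (κ₁ γ₁) (κ₂ γ₂))) ⟩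
      sum² (λ γ₁ γ₂ → w γ₁ γ₂ * (kernel₁ γ₁ β₁ * kernel₂ γ₂ β₂))
        ≈⟨ sum²-kernel w β₁ β₂ ⟩
      w β₁ β₂ * (ofℕ commRing n₁ * ofℕ commRing n₂)
        ≈⟨ trans (*-congˡ (sym (ofℕ-* n₁ n₂))) (*-comm (w β₁ β₂) (ofℕ commRing N)) ⟩
      ofℕ commRing N * w β₁ β₂ ∎
      where
      χ₁ = χ {n₁} a₁ n₂
      χ₂ = χ {n₂} a₂ n₁
      κ₁ : Fin n₁ → Fin n₁ → Carrier
      κ₁ γ₁ δ₁ = χ₁ δ₁ β₁ * eB₁ γ₁ δ₁
      κ₂ : Fin n₂ → Fin n₂ → Carrier
      κ₂ γ₂ δ₂ = χ₂ δ₂ β₂ * eB₂ γ₂ δ₂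
      summand : Fin n₁ → Fin n₂ → Fin n₁ → Fin n₂ → Carrier
      summand δ₁ δ₂ γ₁ γ₂ = (χ₁ δ₁ β₁ * χ₂ δ₂ β₂) * ((eB₁ γ₁ δ₁ * eB₂ γ₂ δ₂) * w γ₁ γ₂)
      regroup : ∀ i₁ i₂ b₁ b₂ x → (i₁ * i₂) * ((b₁ * b₂) * x) ≈ x * ((i₁ * b₁) * (i₂ * b₂))
      regroup = solve 5 (λ i₁ i₂ b₁ b₂ x →
        (i₁ :* i₂) :* ((b₁ :* b₂) :* x) := x :* ((i₁ :* b₁) :* (i₂ :* b₂))) refl

    𝓕≈0⇒≈0 : ∀ {w} → (∀ β₁ β₂ → 𝓕 w β₁ β₂ ≈ 0#) → ∀ x y → w x y ≈ 0#
    𝓕≈0⇒≈0 {w} 𝓕w≈0 x y = nonzero-cancelˡ (ofℕ-nonzero (ℕ.≢-nonZero⁻¹ N))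
      (trans (sym (𝓕⁻∘𝓕 w x y)) (𝓕⁻-zero 𝓕w≈0 x y))

    sum²-𝓕 : ∀ w → sum² (𝓕 w) ≈ ofℕ commRing N * w origin₁ origin₂
    sum²-𝓕 w = trans (sum²-cong {n₁} {n₂} (λ δ₁ δ₂ → sym (trans (*-congʳ (trans
      (*-cong (χ-origin a₁ n₂ δ₁ origin₁ Z-origin₁) (χ-origin a₂ n₁ δ₂ origin₂ Z-origin₂))
      (*-identityˡ 1#))) (*-identityˡ _))))
      (𝓕⁻∘𝓕 w origin₁ origin₂)

module Γ₀InvariantsVanish
  {c ℓ : Level} (F : CharZeroField c ℓ)
  (p j₁ j₂ : ℕ) (p-prime : Prime p) (p-odd : p ℕ.% 2 ≡ 1) (k-odd : Odd (suc j₁ ℕ.+ suc j₂))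
  (a₁ a₂ : ℤ) (p∤a₁ : ¬ (p ℕ∣.∣ ∣ a₁ ∣)) (p∤a₂ : ¬ (p ℕ∣.∣ ∣ a₂ ∣))
  (ζ : CharZeroField.Carrier F)
  (ζ-primitive : FieldOps.IsPrimitiveRoot F ζ (p ℕ.^ suc j₁ ℕ.* p ℕ.^ suc j₂))
  (v : Weil.Vec F ζ (p ℕ.^ suc j₁) (p ℕ.^ suc j₂) a₁ a₂)
  (v-invariant : Weil.Γ₀Invariant F ζ (p ℕ.^ suc j₁) (p ℕ.^ suc j₂) a₁ a₂ p v)
  where
  open import Data.Nat using (_^_)
  open import Data.Integer.Divisibility.Signed as ℤ∣ using (_∣_; _∣?_; divides)
  open import Data.List using ([]; _∷_; _++_)
  open PrimePowerDivisibility p p-prime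

  k₁ k₂ n₁ n₂ : ℕ
  k₁ = suc j₁
  k₂ = suc j₂
  n₁ = p ^ k₁
  n₂ = p ^ k₂

  instance
    n₁≢0 : ℕ.NonZero n₁
    n₁≢0 = ℕP.m^n≢0 p k₁
    n₂≢0 : ℕ.NonZero n₂
    n₂≢0 = ℕP.m^n≢0 p k₂

  open CharZeroField F
  open FieldOps F
  open FieldProperties F
  open Weil F ζ n₁ n₂ a₁ a₂
  open FourierAnalysis F ζ n₁ n₂ a₁ a₂ ζ-primitive
  open GeneratorWords
  open import Relation.Binary.Reasoning.Setoid setoid
  open Inversion
    (λ d → ∣-scaled⇒∣ k₁ k₂ (+ 2 ℤ.* a₁) d (odd-prime∤2* p-odd a₁ p∤a₁))
    (λ d → ∣-scaled⇒∣ k₂ k₁ (+ 2 ℤ.* a₂) d (odd-prime∤2* p-odd a₂ p∤a₂)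
             ∘ ≡.subst (λ t → + t ∣ + 2 ℤ.* a₂ ℤ.* d ℤ.* + n₁) (ℕP.*-comm n₁ n₂))

  -- q = N · Q, so that e(Q(x, y)) = eN (q x y).
  q : Fin n₁ → Fin n₂ → ℤ
  q x y = a₁ ℤ.* Z x ℤ.* Z x ℤ.* + n₂ ℤ.+ a₂ ℤ.* Z y ℤ.* Z y ℤ.* + n₁

  eQ≈eN-q : ∀ x y → eQ₁ x * eQ₂ y ≈ eN (q x y)
  eQ≈eN-q x y = sym (eN-+ (a₁ ℤ.* Z x ℤ.* Z x ℤ.* + n₂) (a₂ ℤ.* Z y ℤ.* Z y ℤ.* + n₁))

  ρWord-++ : ∀ w w′ u → ρWord (w ++ w′) u ≡ ρWord w (ρWord w′ u)
  ρWord-++ []      w′ u = ≡.refl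
  ρWord-++ (g ∷ w) w′ u = ≡.cong (ρGen g) (ρWord-++ w w′ u)

  ρWord-Tᵐ : ∀ m u x y → ρWord (Tᵐ m) u x y ≈ pow (eN (q x y)) m * u x y
  ρWord-Tᵐ zero    u x y = sym (*-identityˡ _)
  ρWord-Tᵐ (suc m) u x y = trans (*-cong (eQ≈eN-q x y) (ρWord-Tᵐ m u x y)) (sym (*-assoc _ _ _))

  ρWord-Tᵐ′ : ∀ m u x y → ρWord (Tᵐ m) u x y ≈ eN (+ m ℤ.* q x y) * u x y
  ρWord-Tᵐ′ m u x y = trans (ρWord-Tᵐ m u x y) (*-congʳ (sym (eN-*ℕ m (q x y))))

  invariant : ∀ w → + p ∣ lowerLeft w → ∀ x y → ρWord w v x y ≈ v x y
  invariant w p∣c = v-invariant w (ℤ∣.∣⇒∣ᵤ p∣c)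

  -- ρS w unfolds to σ * 𝓕 w.
  σ σ² : Carrier
  σ  = G₁ ⁻¹ * G₂ ⁻¹
  σ² = σ * σ

  u : Vec
  u = 𝓕 v

  s : Carrier
  s = sum² v

  v≈0-off-isotropic : ∀ x y → ¬ (+ N ∣ q x y) → v x y ≈ 0#
  v≈0-off-isotropic x y N∤q = x*y≈y⇒y≈0
    (invariant (genT ∷ []) (divides (+ 0) ≡.refl) x y)
    (λ eQ≈1 → N∤q (eN≈1⇒∣ (trans (sym (eQ≈eN-q x y)) eQ≈1)))

  𝓕[σ²u]≈v : ∀ β₁ β₂ → 𝓕 (λ x y → σ² * u x y) β₁ β₂ ≈ v β₁ β₂
  𝓕[σ²u]≈v β₁ β₂ = begin
    𝓕 (λ x y → σ² * u x y) β₁ β₂     ≈⟨ 𝓕-*ˡ σ² u β₁ β₂ ⟩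
    σ² * 𝓕 u β₁ β₂                   ≈⟨ *-assoc σ σ _ ⟩
    σ * (σ * 𝓕 u β₁ β₂)              ≈⟨ *-congˡ (𝓕-*ˡ σ u β₁ β₂) ⟨
    ρWord (genS ∷ genS ∷ []) v β₁ β₂  ≈⟨ invariant (genS ∷ genS ∷ []) (divides (+ 0) ≡.refl) β₁ β₂ ⟩
    v β₁ β₂                          ∎

  𝓕[σ²eᵖu]≈v : ∀ β₁ β₂ → 𝓕 (λ x y → σ² * (eN (+ p ℤ.* q x y) * u x y)) β₁ β₂ ≈ v β₁ β₂
  𝓕[σ²eᵖu]≈v β₁ β₂ = begin
    𝓕 (λ x y → σ² * eᵖu x y) β₁ β₂            ≈⟨ 𝓕-*ˡ σ² eᵖu β₁ β₂ ⟩
    σ² * 𝓕 eᵖu β₁ β₂                          ≈⟨ *-assoc σ σ _ ⟩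
    σ * (σ * 𝓕 eᵖu β₁ β₂)                     ≈⟨ *-congˡ (𝓕-*ˡ σ eᵖu β₁ β₂) ⟨
    σ * 𝓕 (λ x y → σ * eᵖu x y) β₁ β₂         ≈⟨ *-congˡ (𝓕-cong (λ x y → trans
                                                    (ρWord-Tᵐ′ p (ρS v) x y) (x∙yz≈y∙xz _ σ _)) β₁ β₂) ⟨
    ρS (ρWord (Tᵐ p) (ρS v)) β₁ β₂            ≡⟨ ≡.cong (λ w → ρS w β₁ β₂) (ρWord-++ (Tᵐ p) (genS ∷ []) v) ⟨
    ρWord (STᵐS p) v β₁ β₂
      ≈⟨ invariant (STᵐS p) (≡.subst (+ p ∣_) (≡.sym (lowerLeft-STᵐS p)) ℤ∣.∣-refl) β₁ β₂ ⟩
    v β₁ β₂                                   ∎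
    where
    eᵖu : Vec
    eᵖu x y = eN (+ p ℤ.* q x y) * u x y

  σ²u-fixed-by-eᵖ : ∀ x y → eN (+ p ℤ.* q x y) * (σ² * u x y) ≈ σ² * u x y
  σ²u-fixed-by-eᵖ x y =
    x∙y⁻¹≈ε⇒x≈y _ _ (trans (+-congʳ (x∙yz≈y∙xz _ σ² _)) (𝓕≈0⇒≈0 𝓕[difference]≈0 x y))
    where
    open import Algebra.Properties.AbelianGroup +-abelianGroup using (x∙y⁻¹≈ε⇒x≈y)
    𝓕[difference]≈0 : ∀ β₁ β₂ → 𝓕 (λ x y → σ² * (eN (+ p ℤ.* q x y) * u x y) - σ² * u x y) β₁ β₂ ≈ 0#
    𝓕[difference]≈0 β₁ β₂ = trans (𝓕-minus _ _ β₁ β₂)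
      (trans (+-cong (𝓕[σ²eᵖu]≈v β₁ β₂) (-‿cong (𝓕[σ²u]≈v β₁ β₂))) (-‿inverseʳ _))

  σ²u≈0-off-p-isotropic : ∀ x y → ¬ (+ N ∣ + p ℤ.* q x y) → σ² * u x y ≈ 0#
  σ²u≈0-off-p-isotropic x y N∤pq = x*y≈y⇒y≈0 (σ²u-fixed-by-eᵖ x y) (N∤pq ∘ eN≈1⇒∣)

  q≡terms : ∀ x y → q x y ≡ term a₁ (toℕ x) k₂ ℤ.+ term a₂ (toℕ y) k₁
  q≡terms x y = ≡.cong₂ ℤ._+_ (as-term a₁ (toℕ x) n₂) (as-term a₂ (toℕ y) n₁)
    where
    reassoc : ∀ a x m → a ℤ.* x ℤ.* x ℤ.* m ≡ a ℤ.* (x ℤ.* x ℤ.* m)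
    reassoc = ℤSolver.solve-∀
    as-term : ∀ a x m → a ℤ.* + x ℤ.* + x ℤ.* + m ≡ a ℤ.* + (x ℕ.* x ℕ.* m)
    as-term a x m = ≡.trans (reassoc a (+ x) (+ m)) (≡.cong (a ℤ.*_)
      (≡.trans (≡.cong (ℤ._* + m) (≡.sym (ℤP.pos-* x x))) (≡.sym (ℤP.pos-* (x ℕ.* x) m))))

  N≡p^[k₁+k₂] : + N ≡ pℤ^ (k₁ ℕ.+ k₂)
  N≡p^[k₁+k₂] = ≡.cong +_ (≡.sym (ℕP.^-distribˡ-+-* p k₁ k₂))

  k-odd′ : Odd (k₂ ℕ.+ k₁)
  k-odd′ = Odd-+-comm {k₁} {k₂} k-odd

  j₁+k₂≡j₂+k₁ : j₁ ℕ.+ k₂ ≡ j₂ ℕ.+ k₁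
  j₁+k₂≡j₂+k₁ =
    ≡.trans (ℕP.+-suc j₁ j₂) (≡.trans (≡.cong suc (ℕP.+-comm j₁ j₂)) (≡.sym (ℕP.+-suc j₂ j₁)))

  isotropic⇒ : ∀ x y → + N ∣ q x y → (p ^ ⌈ k₁ /2⌉ ℕ∣.∣ toℕ x) × (p ^ ⌈ k₂ /2⌉ ℕ∣.∣ toℕ y)
  isotropic⇒ x y N∣q = ∣-sum⇒^⌈/2⌉∣ k₂ k₁ k₁ k₂ a₁ a₂ (toℕ x) (toℕ y) p∤a₁ p∤a₂ k-odd′
    ≡.refl (ℕP.+-comm k₁ k₂) (≡.subst₂ _∣_ N≡p^[k₁+k₂] (q≡terms x y) N∣q)

  isotropic⇐ : ∀ x y → p ^ ⌈ k₁ /2⌉ ℕ∣.∣ toℕ x → p ^ ⌈ k₂ /2⌉ ℕ∣.∣ toℕ y → + N ∣ q x y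
  isotropic⇐ x y hx hy = ≡.subst₂ _∣_ (≡.sym N≡p^[k₁+k₂]) (≡.sym (q≡terms x y))
    (^⌈/2⌉∣⇒∣-sum k₂ k₁ k₁ k₂ a₁ a₂ (toℕ x) (toℕ y) ≡.refl (ℕP.+-comm k₁ k₂) hx hy)

  p-isotropic⇒ : ∀ x y → + N ∣ + p ℤ.* q x y → (p ^ ⌈ j₁ /2⌉ ℕ∣.∣ toℕ x) × (p ^ ⌈ j₂ /2⌉ ℕ∣.∣ toℕ y)
  p-isotropic⇒ x y N∣pq = ∣-sum⇒^⌈/2⌉∣ k₂ k₁ j₁ j₂ a₁ a₂ (toℕ x) (toℕ y) p∤a₁ p∤a₂ k-odd′
    ≡.refl j₁+k₂≡j₂+k₁
    (≡.subst (pℤ^ (j₁ ℕ.+ k₂) ∣_) (q≡terms x y)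
      (∣-cancel-p (j₁ ℕ.+ k₂) (q x y) (≡.subst (_∣ + p ℤ.* q x y) N≡p^[k₁+k₂] N∣pq)))

  p-isotropic⇐ : ∀ x y → p ^ ⌈ j₁ /2⌉ ℕ∣.∣ toℕ x → p ^ ⌈ j₂ /2⌉ ℕ∣.∣ toℕ y → + N ∣ + p ℤ.* q x y
  p-isotropic⇐ x y hx hy = ≡.subst (_∣ + p ℤ.* q x y) (≡.sym N≡p^[k₁+k₂])
    (∣-mul-p (j₁ ℕ.+ k₂) (q x y) (≡.subst (pℤ^ (j₁ ℕ.+ k₂) ∣_) (≡.sym (q≡terms x y))
      (^⌈/2⌉∣⇒∣-sum k₂ k₁ j₁ j₂ a₁ a₂ (toℕ x) (toℕ y) ≡.refl j₁+k₂≡j₂+k₁ hx hy)))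

  eB≈1 : ∀ γ₁ γ₂ β₁ β₂ → + N ∣ q γ₁ γ₂ → + N ∣ + p ℤ.* q β₁ β₂ → eB₁ γ₁ β₁ * eB₂ γ₂ β₂ ≈ 1#
  eB≈1 γ₁ γ₂ β₁ β₂ N∣qγ N∣pqβ = trans (*-cong
    (∣⇒eN≈1 (ℤ∣.∣m⇒∣-m
      (^⌈/2⌉∣-product j₁ k₂ (+ 2 ℤ.* a₁) (toℕ γ₁) (toℕ β₁) (proj₁ γ-divs) (proj₁ β-divs))))
    (∣⇒eN≈1 (ℤ∣.∣m⇒∣-m (≡.subst (λ t → + t ∣ + 2 ℤ.* a₂ ℤ.* Z γ₂ ℤ.* Z β₂ ℤ.* + n₁) (ℕP.*-comm n₂ n₁)
      (^⌈/2⌉∣-product j₂ k₁ (+ 2 ℤ.* a₂) (toℕ γ₂) (toℕ β₂) (proj₂ γ-divs) (proj₂ β-divs))))))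
    (*-identityˡ 1#)
    where
    γ-divs = isotropic⇒ γ₁ γ₂ N∣qγ
    β-divs = p-isotropic⇒ β₁ β₂ N∣pqβ

  u≈s-on-p-isotropic : ∀ β₁ β₂ → + N ∣ + p ℤ.* q β₁ β₂ → u β₁ β₂ ≈ s
  u≈s-on-p-isotropic β₁ β₂ N∣pqβ = sum²-cong {n₁} {n₂} term≈v
    where
    term≈v : ∀ γ₁ γ₂ → (eB₁ γ₁ β₁ * eB₂ γ₂ β₂) * v γ₁ γ₂ ≈ v γ₁ γ₂
    term≈v γ₁ γ₂ with + N ∣? q γ₁ γ₂
    ... | yes N∣qγ = trans (*-congʳ (eB≈1 γ₁ γ₂ β₁ β₂ N∣qγ N∣pqβ)) (*-identityˡ _)
    ... | no  N∤qγ = trans (*-congˡ (v≈0-off-isotropic γ₁ γ₂ N∤qγ))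
                           (trans (zeroʳ _) (sym (v≈0-off-isotropic γ₁ γ₂ N∤qγ)))

  𝟙ₚ : Fin n₁ → Fin n₂ → Carrier
  𝟙ₚ x y = indicator (+ N ∣? + p ℤ.* q x y)

  σ²u≈𝟙ₚσ²s : ∀ x y → σ² * u x y ≈ 𝟙ₚ x y * (σ² * s)
  σ²u≈𝟙ₚσ²s x y with + N ∣? + p ℤ.* q x y
  ... | yes N∣pq = trans (*-congˡ (u≈s-on-p-isotropic x y N∣pq)) (sym (*-identityˡ _))
  ... | no  N∤pq = trans (σ²u≈0-off-p-isotropic x y N∤pq) (sym (zeroˡ _))

  q-origin : q origin₁ origin₂ ≡ + 0
  q-origin = ≡.trans
    (≡.cong₂ (λ t t′ → a₁ ℤ.* t ℤ.* t ℤ.* + n₂ ℤ.+ a₂ ℤ.* t′ ℤ.* t′ ℤ.* + n₁) Z-origin₁ Z-origin₂)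
    (vanish a₁ a₂ (+ n₂) (+ n₁))
    where
    vanish : ∀ a b m n → a ℤ.* + 0 ℤ.* + 0 ℤ.* m ℤ.+ b ℤ.* + 0 ℤ.* + 0 ℤ.* n ≡ + 0
    vanish = ℤSolver.solve-∀

  ρWord-Tᵐ-ρS-at-origin : ∀ m w → ρWord (Tᵐ m) (ρS w) origin₁ origin₂ ≈ σ * sum² w
  ρWord-Tᵐ-ρS-at-origin m w = begin
    ρWord (Tᵐ m) (ρS w) origin₁ origin₂                ≈⟨ ρWord-Tᵐ′ m (ρS w) origin₁ origin₂ ⟩
    eN (+ m ℤ.* q origin₁ origin₂) * ρS w origin₁ origin₂
      ≈⟨ *-congʳ (∣⇒eN≈1 (divides (+ 0) (≡.trans (≡.cong (+ m ℤ.*_) q-origin) (ℤP.*-zeroʳ (+ m))))) ⟩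
    1# * ρS w origin₁ origin₂                          ≈⟨ *-identityˡ _ ⟩
    σ * 𝓕 w origin₁ origin₂                            ≈⟨ *-congˡ (𝓕-at-origin w) ⟩
    σ * sum² w                                         ∎

  σ*ρWord-Tⁿ-ρS-v : ∀ n x y → σ * ρWord (Tᵐ n) (ρS v) x y ≈ (σ² * s) * (𝟙ₚ x y * eN (+ n ℤ.* q x y))
  σ*ρWord-Tⁿ-ρS-v n x y = begin
    σ * ρWord (Tᵐ n) (ρS v) x y               ≈⟨ *-congˡ (ρWord-Tᵐ′ n (ρS v) x y) ⟩
    σ * (eN (+ n ℤ.* q x y) * (σ * u x y))    ≈⟨ x∙yz≈y∙xz σ _ _ ⟩
    eN (+ n ℤ.* q x y) * (σ * (σ * u x y))    ≈⟨ *-congˡ (*-assoc σ σ _) ⟨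
    eN (+ n ℤ.* q x y) * (σ² * u x y)         ≈⟨ *-congˡ (σ²u≈𝟙ₚσ²s x y) ⟩
    eN (+ n ℤ.* q x y) * (𝟙ₚ x y * (σ² * s))  ≈⟨ x∙yz≈z∙xy _ _ _ ⟩
    (σ² * s) * (eN (+ n ℤ.* q x y) * 𝟙ₚ x y)  ≈⟨ *-congˡ (*-comm _ _) ⟩
    (σ² * s) * (𝟙ₚ x y * eN (+ n ℤ.* q x y))  ∎

  K : Carrier
  K = ofℕ commRing N * σ * (σ² * s)

  s≈K*sum : ∀ m n → + p ∣ + m ℤ.* + n ℤ.- + 1 → s ≈ K * sum² (λ x y → 𝟙ₚ x y * eN (+ n ℤ.* q x y))
  s≈K*sum m n p∣mn-1 = begin
    sum² v                                        ≈⟨ sum²-cong {n₁} {n₂} (invariant (STᵐSTⁿS m n) p∣c) ⟨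
    sum² (ρWord (STᵐSTⁿS m n) v)                  ≡⟨ ≡.cong sum² word-action ⟩
    sum² (ρS h)                                   ≈⟨ *-distribˡ-sum² {n₁} {n₂} σ (𝓕 h) ⟨
    σ * sum² (𝓕 h)                                ≈⟨ *-congˡ (sum²-𝓕 h) ⟩
    σ * (ofℕ commRing N * h origin₁ origin₂)     ≈⟨ *-congˡ (*-congˡ (ρWord-Tᵐ-ρS-at-origin m h₁)) ⟩
    σ * (ofℕ commRing N * (σ * sum² h₁))         ≈⟨ regroup σ (ofℕ commRing N) (sum² h₁) ⟩
    ofℕ commRing N * σ * (σ * sum² h₁)           ≈⟨ *-congˡ (*-distribˡ-sum² {n₁} {n₂} σ h₁) ⟩
    ofℕ commRing N * σ * sum² (λ x y → σ * h₁ x y)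
      ≈⟨ *-congˡ (sum²-cong {n₁} {n₂} (σ*ρWord-Tⁿ-ρS-v n)) ⟩
    ofℕ commRing N * σ * sum² (λ x y → (σ² * s) * (𝟙ₚ x y * eN (+ n ℤ.* q x y)))
      ≈⟨ *-congˡ (*-distribˡ-sum² {n₁} {n₂} (σ² * s) _) ⟨
    ofℕ commRing N * σ * ((σ² * s) * sum² (λ x y → 𝟙ₚ x y * eN (+ n ℤ.* q x y)))
      ≈⟨ *-assoc _ _ _ ⟨
    K * sum² (λ x y → 𝟙ₚ x y * eN (+ n ℤ.* q x y)) ∎
    where
    p∣c : + p ∣ lowerLeft (STᵐSTⁿS m n)
    p∣c = ≡.subst (+ p ∣_) (≡.sym (lowerLeft-STᵐSTⁿS m n)) p∣mn-1
    h₁ h : Vec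
    h₁ = ρWord (Tᵐ n) (ρS v)
    h  = ρWord (Tᵐ m) (ρS h₁)
    word-action : ρWord (STᵐSTⁿS m n) v ≡ ρS h
    word-action = ≡.trans (≡.cong ρS (ρWord-++ (Tᵐ m) (genS ∷ Tᵐ n ++ genS ∷ []) v))
                          (≡.cong (λ w → ρS (ρWord (Tᵐ m) (ρS w))) (ρWord-++ (Tᵐ n) (genS ∷ []) v))
    regroup : ∀ a b d → a * (b * (a * d)) ≈ b * a * (a * d)
    regroup a b d = trans (x∙yz≈y∙xz a b _) (sym (*-assoc b a _))

  𝟙 : Fin n₁ → Fin n₂ → Carrier
  𝟙 x y = indicator (+ N ∣? q x y)

  count-multiples-of-p^ : ∀ k a h → a ℕ.+ h ≡ k →
    sumFin {p ^ k} (λ x → indicator (p ^ h ℕ∣.∣? toℕ x)) ≈ ofℕ commRing (p ^ a)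
  count-multiples-of-p^ k a h ≡.refl =
    ≡.subst (λ n → sumRange n (λ y → indicator (p ^ h ℕ∣.∣? y)) ≈ ofℕ commRing (p ^ a))
            (≡.sym (ℕP.^-distribˡ-+-* p a h)) (count-multiples (p ^ a) (p ^ h) {{ℕP.m^n≢0 p h}})

  count-lattice : ∀ {A : Fin n₁ → Fin n₂ → Set} (A? : ∀ x y → Dec (A x y)) a₁′ h₁ a₂′ h₂ →
    a₁′ ℕ.+ h₁ ≡ k₁ → a₂′ ℕ.+ h₂ ≡ k₂ →
    (∀ x y → A x y → (p ^ h₁ ℕ∣.∣ toℕ x) × (p ^ h₂ ℕ∣.∣ toℕ y)) →
    (∀ x y → p ^ h₁ ℕ∣.∣ toℕ x → p ^ h₂ ℕ∣.∣ toℕ y → A x y) →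
    sum² (λ x y → indicator (A? x y)) ≈ ofℕ commRing (p ^ a₁′) * ofℕ commRing (p ^ a₂′)
  count-lattice A? a₁′ h₁ a₂′ h₂ e₁ e₂ A⇒ ⇒A = begin
    sum² (λ x y → indicator (A? x y))
      ≈⟨ sum²-cong {n₁} {n₂} (λ x y → indicator-× (χ₁ x) (χ₂ y) (A? x y) (A⇒ x y) (⇒A x y)) ⟩
    sum² {n₁} {n₂} (λ x y → indicator (χ₁ x) * indicator (χ₂ y))
      ≈⟨ sum²-product {n₁} {n₂} (λ x → indicator (χ₁ x)) (λ y → indicator (χ₂ y)) ⟩
    sumFin {n₁} (λ x → indicator (χ₁ x)) * sumFin {n₂} (λ y → indicator (χ₂ y))
      ≈⟨ *-cong (count-multiples-of-p^ k₁ a₁′ h₁ e₁) (count-multiples-of-p^ k₂ a₂′ h₂ e₂) ⟩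
    ofℕ commRing (p ^ a₁′) * ofℕ commRing (p ^ a₂′) ∎
    where
    χ₁ = λ (x : Fin n₁) → p ^ h₁ ℕ∣.∣? toℕ x
    χ₂ = λ (y : Fin n₂) → p ^ h₂ ℕ∣.∣? toℕ y

  count-isotropic : sum² 𝟙 ≈ ofℕ commRing (p ^ ⌈ j₁ /2⌉) * ofℕ commRing (p ^ ⌈ j₂ /2⌉)
  count-isotropic = count-lattice (λ x y → + N ∣? q x y) ⌈ j₁ /2⌉ ⌈ k₁ /2⌉ ⌈ j₂ /2⌉ ⌈ k₂ /2⌉
    (ℕP.⌊n/2⌋+⌈n/2⌉≡n k₁) (ℕP.⌊n/2⌋+⌈n/2⌉≡n k₂) isotropic⇒ isotropic⇐

  count-p-isotropic : sum² 𝟙ₚ ≈ ofℕ commRing (p ^ ⌈ k₁ /2⌉) * ofℕ commRing (p ^ ⌈ k₂ /2⌉)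
  count-p-isotropic = count-lattice (λ x y → + N ∣? + p ℤ.* q x y) ⌈ k₁ /2⌉ ⌈ j₁ /2⌉ ⌈ k₂ /2⌉ ⌈ j₂ /2⌉
    (⌈suc/2⌉+⌈/2⌉≡suc j₁) (⌈suc/2⌉+⌈/2⌉≡suc j₂) p-isotropic⇒ p-isotropic⇐

  M : ℕ
  M = p ^ (j₁ ℕ.+ k₂)

  N≡M*p : N ≡ M ℕ.* p
  N≡M*p = ≡.trans (≡.sym (ℕP.^-distribˡ-+-* p k₁ k₂)) (ℕP.*-comm p M)

  isotropic-count : sum² (λ x y → 𝟙ₚ x y * (ofℕ commRing N * 𝟙 x y - ofℕ commRing M)) ≈ 0#
  isotropic-count = begin
    sum² (λ x y → 𝟙ₚ x y * (ofℕ commRing N * 𝟙 x y - ofℕ commRing M))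
      ≈⟨ sum²-cong {n₁} {n₂} (λ x y → absorb (+ N ∣? + p ℤ.* q x y) (+ N ∣? q x y) (ℤ∣.∣n⇒∣m*n (+ p))) ⟩
    sum² (λ x y → ofℕ commRing N * 𝟙 x y - ofℕ commRing M * 𝟙ₚ x y)
      ≈⟨ sum²-minus {n₁} {n₂} _ _ ⟩
    sum² (λ x y → ofℕ commRing N * 𝟙 x y) - sum² (λ x y → ofℕ commRing M * 𝟙ₚ x y)
      ≈⟨ +-cong (sym (*-distribˡ-sum² {n₁} {n₂} _ 𝟙)) (-‿cong (sym (*-distribˡ-sum² {n₁} {n₂} _ 𝟙ₚ))) ⟩
    ofℕ commRing N * sum² 𝟙 - ofℕ commRing M * sum² 𝟙ₚ
      ≈⟨ +-cong (*-congˡ count-isotropic) (-‿cong (*-congˡ count-p-isotropic)) ⟩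
    ofℕ commRing N * (ofℕ commRing (p ^ ⌈ j₁ /2⌉) * ofℕ commRing (p ^ ⌈ j₂ /2⌉)) -
    ofℕ commRing M * (ofℕ commRing (p ^ ⌈ k₁ /2⌉) * ofℕ commRing (p ^ ⌈ k₂ /2⌉))
      ≈⟨ +-cong (as-ofℕ N (p ^ ⌈ j₁ /2⌉) (p ^ ⌈ j₂ /2⌉))
                (-‿cong (as-ofℕ M (p ^ ⌈ k₁ /2⌉) (p ^ ⌈ k₂ /2⌉))) ⟩
    ofℕ commRing (N ℕ.* (p ^ ⌈ j₁ /2⌉ ℕ.* p ^ ⌈ j₂ /2⌉)) -
    ofℕ commRing (M ℕ.* (p ^ ⌈ k₁ /2⌉ ℕ.* p ^ ⌈ k₂ /2⌉))
      ≡⟨ ≡.cong (λ t → ofℕ commRing t - ofℕ commRing (M ℕ.* (p ^ ⌈ k₁ /2⌉ ℕ.* p ^ ⌈ k₂ /2⌉)))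
                (isotropic-count-balance j₁ j₂ k-odd) ⟩
    ofℕ commRing (M ℕ.* (p ^ ⌈ k₁ /2⌉ ℕ.* p ^ ⌈ k₂ /2⌉)) -
    ofℕ commRing (M ℕ.* (p ^ ⌈ k₁ /2⌉ ℕ.* p ^ ⌈ k₂ /2⌉))
      ≈⟨ -‿inverseʳ _ ⟩
    0# ∎
    where
    as-ofℕ : ∀ a b d → ofℕ commRing a * (ofℕ commRing b * ofℕ commRing d) ≈ ofℕ commRing (a ℕ.* (b ℕ.* d))
    as-ofℕ a b d = sym (trans (ofℕ-* a _) (*-congˡ (ofℕ-* b d)))
    absorb : ∀ {A B : Set} (dA : Dec A) (dB : Dec B) → (B → A) →
             indicator dA * (ofℕ commRing N * indicator dB - ofℕ commRing M) ≈
             ofℕ commRing N * indicator dB - ofℕ commRing M * indicator dA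
    absorb (yes _) dB B⇒A = trans (*-identityˡ _) (+-congˡ (-‿cong (sym (*-identityʳ _))))
    absorb (no ¬A) (yes B) B⇒A = ⊥-elim (¬A (B⇒A B))
    absorb (no _)  (no _)  B⇒A = trans (zeroˡ _) (sym (trans
      (+-cong (zeroʳ _) (-‿cong (zeroʳ _))) (-‿inverseʳ 0#)))

  P′ : ℕ
  P′ = ℕ.pred p

  residue : ℕ → ℕ → ℕ
  residue i r = i ℕ.* p ℕ.+ suc r

  s≈K*sum-at-residue : ∀ i r → r ℕ.< P′ →
    s ≈ K * sum² (λ x y → 𝟙ₚ x y * eN (+ residue i r ℤ.* q x y))
  s≈K*sum-at-residue i r r<P′ with inverse-mod-p (residue i r) p∤residue
    where
    p∤residue : ¬ (p ℕ∣.∣ residue i r)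
    p∤residue p∣ = ℕP.<⇒≱ (≡.subst (suc r ℕ.<_) (ℕP.suc-pred p) (ℕ.s≤s r<P′))
      (ℕ∣.∣⇒≤ (ℕ∣.∣m+n∣m⇒∣n p∣ (ℕ∣.n∣m*n i)))
  ... | m , p∣m*residue-1 = s≈K*sum m (residue i r) p∣m*residue-1

  units : Fin n₁ → Fin n₂ → Carrier
  units x y = sumRange M (λ i → sumRange P′ (λ r → eN (+ residue i r ℤ.* q x y)))

  𝟙ₚ*units : ∀ x y → 𝟙ₚ x y * units x y ≈ 𝟙ₚ x y * (ofℕ commRing N * 𝟙 x y - ofℕ commRing M)
  𝟙ₚ*units x y with + N ∣? + p ℤ.* q x y
  ... | yes N∣pq = *-congˡ (eN-sum-units M p P′ (q x y) (≡.sym (ℕP.suc-pred p)) N≡M*p N∣pq)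
  ... | no  _    = trans (zeroˡ _) (sym (zeroˡ _))

  averaged-s : ofℕ commRing M * (ofℕ commRing P′ * s) ≈ K * sum² (λ x y → 𝟙ₚ x y * units x y)
  averaged-s = begin
    ofℕ commRing M * (ofℕ commRing P′ * s)
      ≈⟨ trans (*-congˡ (sym (sumFin-const P′ s))) (sym (sumFin-const M _)) ⟩
    sumRange M (λ i → sumRange P′ (λ r → s))
      ≈⟨ sumRange-cong M (λ i _ → sumRange-cong P′ (s≈K*sum-at-residue i)) ⟩
    sumRange M (λ i → sumRange P′ (λ r → K * sum² (R i r)))
      ≈⟨ sym (*-distribˡ-sum² {M} {P′} K (λ i r → sum² (R (toℕ i) (toℕ r)))) ⟩
    K * sumRange M (λ i → sumRange P′ (λ r → sum² (R i r)))
      ≈⟨ *-congˡ (sum²-comm {M} {P′} {n₁} {n₂} (λ i r → R (toℕ i) (toℕ r))) ⟩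
    K * sum² (λ x y → sumRange M (λ i → sumRange P′ (λ r → R i r x y)))
      ≈⟨ *-congˡ (sum²-cong {n₁} {n₂} (λ x y →
           sym (*-distribˡ-sum² {M} {P′} (𝟙ₚ x y) (λ i r → eN (+ residue (toℕ i) (toℕ r) ℤ.* q x y))))) ⟩
    K * sum² (λ x y → 𝟙ₚ x y * units x y) ∎
    where
    R : ℕ → ℕ → Fin n₁ → Fin n₂ → Carrier
    R i r x y = 𝟙ₚ x y * eN (+ residue i r ℤ.* q x y)

  s≈0 : s ≈ 0#
  s≈0 = nonzero-cancelˡ (ofℕ-nonzero M*P′≢0) (begin
    ofℕ commRing (M ℕ.* P′) * s                                   ≈⟨ *-congʳ (ofℕ-* M P′) ⟩
    ofℕ commRing M * ofℕ commRing P′ * s                          ≈⟨ *-assoc _ _ _ ⟩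
    ofℕ commRing M * (ofℕ commRing P′ * s)                        ≈⟨ averaged-s ⟩
    K * sum² (λ x y → 𝟙ₚ x y * units x y)                         ≈⟨ *-congˡ (sum²-cong {n₁} {n₂} 𝟙ₚ*units) ⟩
    K * sum² (λ x y → 𝟙ₚ x y * (ofℕ commRing N * 𝟙 x y - ofℕ commRing M)) ≈⟨ *-congˡ isotropic-count ⟩
    K * 0#                                                        ≈⟨ zeroʳ K ⟩
    0#                                                            ∎)
    where
    M*P′≢0 : M ℕ.* P′ ≢ 0
    M*P′≢0 = ℕ.≢-nonZero⁻¹ (M ℕ.* P′) {{ℕP.m*n≢0 M P′ {{ℕP.m^n≢0 p (j₁ ℕ.+ k₂)}} {{P′≢0}}}}
      where
      P′≢0 : ℕ.NonZero P′
      P′≢0 = ℕ.>-nonZero (ℕP.pred-mono-≤ (ℕ.nonTrivial⇒n>1 p {{prime⇒nonTrivial p-prime}}))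

  v≈0 : ∀ x y → v x y ≈ 0#
  v≈0 x y = trans (sym (𝓕[σ²u]≈v x y)) (𝓕-zero (λ β₁ β₂ →
    trans (σ²u≈𝟙ₚσ²s β₁ β₂) (trans (*-congˡ (trans (*-congˡ s≈0) (zeroʳ σ²))) (zeroʳ _))) x y)

open import Data.Nat using (_+_; _*_; _^_; _%_; _≥_)

lemma4p15 : ∀ {c ℓ} (F : CharZeroField c ℓ)
    (p k₁ k₂ : ℕ) → Prime p → p % 2 ≡ 1 →
    k₁ ≥ 1 → k₂ ≥ 1 → (k₁ + k₂) % 2 ≡ 1 →
    (a₁ a₂ : ℤ) → Coprime ∣ a₁ ∣ p → Coprime ∣ a₂ ∣ p →
    (ζ : CharZeroField.Carrier F) →
    FieldOps.IsPrimitiveRoot F ζ (p ^ k₁ * p ^ k₂) →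
    (v : Weil.Vec F ζ (p ^ k₁) (p ^ k₂) a₁ a₂) →
    Weil.Γ₀Invariant F ζ (p ^ k₁) (p ^ k₂) a₁ a₂ p v →
    Weil.IsZero F ζ (p ^ k₁) (p ^ k₂) a₁ a₂ v
lemma4p15 F p (suc j₁) (suc j₂) p-prime p-odd (ℕ.s≤s ℕ.z≤n) (ℕ.s≤s ℕ.z≤n) k-odd
          a₁ a₂ a₁⊥p a₂⊥p ζ ζ-primitive v v-invariant =
  Γ₀InvariantsVanish.v≈0 F p j₁ j₂ p-prime p-odd (%2≡1⇒Odd _ k-odd) a₁ a₂
    (coprime⇒∤ a₁⊥p) (coprime⇒∤ a₂⊥p) ζ ζ-primitive v v-invariant
  where open PrimePowerDivisibility p p-prime using (coprime⇒∤)
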